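{- Let $n\ge 2$ be an integer and let $Q_{4n}=\langle x,y : x^{2n}=1,\ x^n=y^2,\ yx=x^{ -1}y\rangle$ be the generalized quaternion group of order $4n$. Let $\Gamma_{Q_{4n}}$ be its non-commuting graph and $D^L(\Gamma_{Q_{4n}})$ its distance Laplacian matrix. Then: (a) $0$ is an eigenvalue of $D^L(\Gamma_{Q_{4n}})$ with multiplicity $1$; (b) each of $4n-2$ and $4n$ is an eigenvalue of $D^L(\Gamma_{Q_{4n}})$ with multiplicity $n$; (c) $6n-4$ is an eigenvalue of $D^L(\Gamma_{Q_{4n}})$ with multiplicity $2n-3$.
   Context: For a finite non-abelian group $G$ with centre $Z(G)$, the non-commuting graph $\Gamma_G$ is the simple undirected graph with vertex set $G\setminus Z(G)$, in which distinct vertices $u,v$ are adjacent if and only if $uv\neq vu$. For a connected graph $H$ with vertices $v_1,\dots,v_N$, the distance matrix $D(H)$ has $(i,j)$ entry equal to the length of a shortest path between $v_i$ and $v_j$; the transmission of $v_i$ is $\sum_j D(H)_{ij}$; $Tr(H)$ is the diagonal matrix whose $i$-th diagonal entry is the transmission of $v_i$; and the distance Laplacian matrix is $D^L(H)=Tr(H)-D(H)$. Multiplicity of an eigenvalue means its multiplicity as a root of the characteristic polynomial. -}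

module Defs where

open import Data.Nat as ℕ using (ℕ; zero; suc; _∸_)
open import Data.Nat.DivMod using (_mod_)
open import Data.Integer as ℤ using (ℤ; +_; -_)
open import Data.Fin as Fin using (Fin; zero; suc; toℕ; punchIn)
open import Data.Bool using (Bool; true; false; not; _∧_; _∨_; if_then_else_)
open import Data.List using (List; []; _∷_; length; lookup; filterᵇ; cartesianProduct; allFin)
open import Data.Product using (_×_; _,_)
open import Relation.Nullary.Decidable using (⌊_⌋)
open import Relation.Binary.PropositionalEquality using (_≡_)
open import Data.Product.Properties using (≡-dec)
open import Data.Bool.Properties using () renaming (_≟_ to _≟B_)

-- Polynomials over ℤ: coefficient lists, lowest degree first.

Poly : Set
Poly = List ℤ

infixl 6 _⊕_
infixl 7 _⊗_

_⊕_ : Poly → Poly → Poly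
[] ⊕ q = q
(a ∷ p) ⊕ [] = a ∷ p
(a ∷ p) ⊕ (b ∷ q) = (a ℤ.+ b) ∷ (p ⊕ q)

scale : ℤ → Poly → Poly
scale c [] = []
scale c (a ∷ p) = (c ℤ.* a) ∷ scale c p

_⊗_ : Poly → Poly → Poly
[] ⊗ q = []
(a ∷ p) ⊗ q = scale a q ⊕ (+ 0 ∷ (p ⊗ q))

const : ℤ → Poly
const c = c ∷ []

X : Poly
X = + 0 ∷ + 1 ∷ []

lin : ℤ → Poly
lin c = (- c) ∷ + 1 ∷ []

_^^_ : Poly → ℕ → Poly
p ^^ zero = const (+ 1)
p ^^ suc k = p ⊗ (p ^^ k)

coeff : Poly → ℕ → ℤ
coeff [] i = + 0
coeff (a ∷ p) zero = a
coeff (a ∷ p) (suc i) = coeff p i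

_≈ₚ_ : Poly → Poly → Set
p ≈ₚ q = ∀ i → coeff p i ≡ coeff q i

alt : ℕ → ℤ
alt zero = + 1
alt (suc k) = - alt k

sumP : (n : ℕ) → (Fin n → Poly) → Poly
sumP zero f = []
sumP (suc n) f = f zero ⊕ sumP n (λ j → f (suc j))

det : (n : ℕ) → (Fin n → Fin n → Poly) → Poly
det zero M = const (+ 1)
det (suc n) M =
  sumP (suc n) (λ j → const (alt (toℕ j)) ⊗ M zero j
                       ⊗ det n (λ r c → M (suc r) (punchIn j c)))

eqFin : {n : ℕ} → Fin n → Fin n → Bool
eqFin i j = ⌊ i Fin.≟ j ⌋

charPoly : (N : ℕ) → (Fin N → Fin N → ℤ) → Poly
charPoly N M = det N (λ i j → if eqFin i j then X ⊕ const (- M i j)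
                                          else const (- M i j))

module NonCommuting {G : Set} (elems : List G) (_·_ : G → G → G)
                    (_==_ : G → G → Bool) where

  commutes : G → G → Bool
  commutes g h = (g · h) == (h · g)

  allL : (G → Bool) → List G → Bool
  allL p [] = true
  allL p (x ∷ xs) = p x ∧ allL p xs

  central : G → Bool
  central g = allL (commutes g) elems

  vertices : List G
  vertices = filterᵇ (λ g → not (central g)) elems

  N : ℕ
  N = length vertices

  vtx : Fin N → G
  vtx = lookup vertices

  adj : Fin N → Fin N → Bool
  adj i j = not (commutes (vtx i) (vtx j))

  anyFin : (n : ℕ) → (Fin n → Bool) → Bool
  anyFin zero f = false
  anyFin (suc n) f = f zero ∨ anyFin n (λ j → f (suc j))

  reach : ℕ → Fin N → Fin N → Bool
  reach zero u v = eqFin u v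
  reach (suc k) u v = reach k u v ∨ anyFin N (λ w → reach k u w ∧ adj w v)

  -- least k < b with f k (b if none)
  minK : ℕ → (ℕ → Bool) → ℕ
  minK zero f = zero
  minK (suc b) f = if f zero then zero else suc (minK b (λ k → f (suc k)))

  -- length of a shortest path (paths have length < N in a graph on N vertices)
  dist : Fin N → Fin N → ℕ
  dist u v = minK N (λ k → reach k u v)

  sumℕ : (n : ℕ) → (Fin n → ℕ) → ℕ
  sumℕ zero f = zero
  sumℕ (suc n) f = f zero ℕ.+ sumℕ n (λ j → f (suc j))

  transmission : Fin N → ℕ
  transmission u = sumℕ N (dist u)

  distLaplacian : Fin N → Fin N → ℤ
  distLaplacian i j =
    (if eqFin i j then + transmission i else + 0) ℤ.- + dist i j

-- Generalised quaternion group Q_{4n}: the pair (i , b) stands for x^i y^b,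
-- with i taken mod 2n.  Relations x^{2n} = 1, y^2 = x^n, y x = x^{-1} y.

QElem : ℕ → Set
QElem n = Fin (2 ℕ.* n) × Bool

qMul : (n : ℕ) → QElem n → QElem n → QElem n
qMul zero (() , _) _
qMul (suc m) (i , false) (j , b) = ((toℕ i ℕ.+ toℕ j) mod (2 ℕ.* suc m)) , b
qMul (suc m) (i , true) (j , false) =
  ((toℕ i ℕ.+ (2 ℕ.* suc m ∸ toℕ j)) mod (2 ℕ.* suc m)) , true
qMul (suc m) (i , true) (j , true) =
  ((toℕ i ℕ.+ (2 ℕ.* suc m ∸ toℕ j) ℕ.+ suc m) mod (2 ℕ.* suc m)) , false

qElems : (n : ℕ) → List (QElem n)
qElems n = cartesianProduct (allFin (2 ℕ.* n)) (false ∷ true ∷ [])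

qEq : (n : ℕ) → QElem n → QElem n → Bool
qEq n g h = ⌊ ≡-dec Fin._≟_ _≟B_ g h ⌋

module Q (n : ℕ) = NonCommuting (qElems n) (qMul n) (qEq n)

QN : ℕ → ℕ
QN n = Q.N n

QDL : (n : ℕ) → Fin (QN n) → Fin (QN n) → ℤ
QDL n = Q.distLaplacian n

{-# OPTIONS --safe #-}
-- On the non-central elements of Q₄ₙ commuting is an equivalence relation whose classes are the
-- 2n − 2 non-central powers of x and the n pairs {x^i y, x^(i+n) y}. Hence the non-commuting graph
-- is complete multipartite on N = 4n − 2 vertices, with distance 2 inside a part and 1 across.
-- For any complete multipartite graph, row reduction of x I − D^L (subtract from each vertex the
-- row of its part's representative, move every column onto its representative's column, subtract
-- a pivot representative's row from the other representatives' rows, and finally add those rows to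
-- the pivot row weighted by part size) leaves a matrix of determinant 1 and shows
--   det (x I − D^L) = x (x − N)^(#parts − 1) ∏_{u not a representative} (x − N − |part u|).
module Submission where

open import Defs
open import Data.Nat using (ℕ)

module Booleans where

  open import Data.Bool using (true; false; not)
  open import Relation.Binary.PropositionalEquality using (_≡_; refl)
  open import Relation.Nullary using (¬_; Dec; yes; no)
  open import Relation.Nullary.Decidable using (⌊_⌋)
  open import Data.Empty using (⊥; ⊥-elim)

  module _ {A : Set} where

    ⌊⌋-yes : (d : Dec A) → A → ⌊ d ⌋ ≡ true
    ⌊⌋-yes (yes _) _ = refl
    ⌊⌋-yes (no ¬a) a = ⊥-elim (¬a a)

    ⌊⌋-no : (d : Dec A) → ¬ A → ⌊ d ⌋ ≡ false
    ⌊⌋-no (yes a) ¬a = ⊥-elim (¬a a)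
    ⌊⌋-no (no _) _ = refl

    ⌊⌋-true⇒ : (d : Dec A) → ⌊ d ⌋ ≡ true → A
    ⌊⌋-true⇒ (yes a) _ = a

    ⌊⌋-false⇒ : (d : Dec A) → ⌊ d ⌋ ≡ false → ¬ A
    ⌊⌋-false⇒ (no ¬a) _ = ¬a

  true≢false : ∀ {b} → b ≡ true → b ≡ false → ⊥
  true≢false refl ()

  not≡true⇒≡false : ∀ {b} → not b ≡ true → b ≡ false
  not≡true⇒≡false {false} _ = refl

  not≡false⇒≡true : ∀ {b} → not b ≡ false → b ≡ true
  not≡false⇒≡true {true} _ = refl

module PolyAlgebra where

  open import Data.Nat using (zero; suc)
  open import Data.Integer as ℤ using (+_; -_; _+_; _*_)
  import Data.Integer.Properties as ℤP
  open import Data.Integer.Solver using (module +-*-Solver)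
  open import Data.List using ([]; _∷_)
  open import Relation.Binary.PropositionalEquality
    using (_≡_; refl; sym; trans; cong; cong₂; module ≡-Reasoning)
  open import Relation.Binary.Bundles using (Setoid)

  infix 4 _≈_
  record _≈_ (p q : Poly) : Set where
    constructor mk≈
    field app : ∀ i → coeff p i ≡ coeff q i
  open _≈_ public

  ≈-refl : ∀ {p} → p ≈ p
  ≈-refl = mk≈ λ i → refl

  ≈-reflexive : ∀ {p q} → p ≡ q → p ≈ q
  ≈-reflexive refl = ≈-refl

  ≈-sym : ∀ {p q} → p ≈ q → q ≈ p
  ≈-sym e = mk≈ λ i → sym (app e i)

  ≈-trans : ∀ {p q r} → p ≈ q → q ≈ r → p ≈ r
  ≈-trans e f = mk≈ λ i → trans (app e i) (app f i)

  ≈-setoid : Setoid _ _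
  ≈-setoid = record
    { Carrier = Poly ; _≈_ = _≈_
    ; isEquivalence = record { refl = ≈-refl ; sym = ≈-sym ; trans = ≈-trans } }

  coeff-⊕ : ∀ p q i → coeff (p ⊕ q) i ≡ coeff p i + coeff q i
  coeff-⊕ [] q i = sym (ℤP.+-identityˡ (coeff q i))
  coeff-⊕ (a ∷ p) [] zero = sym (ℤP.+-identityʳ a)
  coeff-⊕ (a ∷ p) [] (suc i) = sym (ℤP.+-identityʳ (coeff p i))
  coeff-⊕ (a ∷ p) (b ∷ q) zero = refl
  coeff-⊕ (a ∷ p) (b ∷ q) (suc i) = coeff-⊕ p q i

  coeff-scale : ∀ c p i → coeff (scale c p) i ≡ c * coeff p i
  coeff-scale c [] i = sym (ℤP.*-zeroʳ c)
  coeff-scale c (a ∷ p) zero = refl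
  coeff-scale c (a ∷ p) (suc i) = coeff-scale c p i

  module _ where
    open ≡-Reasoning

    ⊕-cong : ∀ {p p′ q q′} → p ≈ p′ → q ≈ q′ → p ⊕ q ≈ p′ ⊕ q′
    ⊕-cong {p} {p′} {q} {q′} e f = mk≈ λ i → begin
      coeff (p ⊕ q) i            ≡⟨ coeff-⊕ p q i ⟩
      coeff p i + coeff q i    ≡⟨ cong₂ _+_ (app e i) (app f i) ⟩
      coeff p′ i + coeff q′ i  ≡⟨ coeff-⊕ p′ q′ i ⟨
      coeff (p′ ⊕ q′) i          ∎

    ⊕-comm : ∀ p q → p ⊕ q ≈ q ⊕ p
    ⊕-comm p q = mk≈ λ i → begin
      coeff (p ⊕ q) i          ≡⟨ coeff-⊕ p q i ⟩
      coeff p i + coeff q i  ≡⟨ ℤP.+-comm (coeff p i) _ ⟩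
      coeff q i + coeff p i  ≡⟨ coeff-⊕ q p i ⟨
      coeff (q ⊕ p) i          ∎

    ⊕-assoc : ∀ p q r → (p ⊕ q) ⊕ r ≈ p ⊕ (q ⊕ r)
    ⊕-assoc p q r = mk≈ λ i → begin
      coeff ((p ⊕ q) ⊕ r) i                        ≡⟨ coeff-⊕ (p ⊕ q) r i ⟩
      coeff (p ⊕ q) i + coeff r i                ≡⟨ cong (_+ coeff r i) (coeff-⊕ p q i) ⟩
      (coeff p i + coeff q i) + coeff r i      ≡⟨ ℤP.+-assoc (coeff p i) _ _ ⟩
      coeff p i + (coeff q i + coeff r i)      ≡⟨ cong (λ z → coeff p i + z) (coeff-⊕ q r i) ⟨
      coeff p i + coeff (q ⊕ r) i                ≡⟨ coeff-⊕ p (q ⊕ r) i ⟨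
      coeff (p ⊕ (q ⊕ r)) i                        ∎

    ⊕-interchange : ∀ a b c d → (a ⊕ b) ⊕ (c ⊕ d) ≈ (a ⊕ c) ⊕ (b ⊕ d)
    ⊕-interchange a b c d = mk≈ λ i → begin
      coeff ((a ⊕ b) ⊕ (c ⊕ d)) i
        ≡⟨ trans (coeff-⊕ (a ⊕ b) _ i) (cong₂ _+_ (coeff-⊕ a b i) (coeff-⊕ c d i)) ⟩
      (coeff a i + coeff b i) + (coeff c i + coeff d i)
        ≡⟨ exchange (coeff a i) (coeff b i) (coeff c i) (coeff d i) ⟩
      (coeff a i + coeff c i) + (coeff b i + coeff d i)
        ≡⟨ trans (coeff-⊕ (a ⊕ c) _ i) (cong₂ _+_ (coeff-⊕ a c i) (coeff-⊕ b d i)) ⟨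
      coeff ((a ⊕ c) ⊕ (b ⊕ d)) i ∎
      where
      open +-*-Solver
      exchange : ∀ w x y z → (w + x) + (y + z) ≡ (w + y) + (x + z)
      exchange = solve 4 (λ w x y z → (w :+ x) :+ (y :+ z) := (w :+ y) :+ (x :+ z)) refl

    scale-cong : ∀ c {p q} → p ≈ q → scale c p ≈ scale c q
    scale-cong c {p} {q} e = mk≈ λ i → begin
      coeff (scale c p) i   ≡⟨ coeff-scale c p i ⟩
      c * coeff p i       ≡⟨ cong (c *_) (app e i) ⟩
      c * coeff q i       ≡⟨ coeff-scale c q i ⟨
      coeff (scale c q) i   ∎

    scale-distrib-⊕ : ∀ c p q → scale c (p ⊕ q) ≈ scale c p ⊕ scale c q
    scale-distrib-⊕ c p q = mk≈ λ i → begin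
      coeff (scale c (p ⊕ q)) i                    ≡⟨ coeff-scale c (p ⊕ q) i ⟩
      c * coeff (p ⊕ q) i                        ≡⟨ cong (c *_) (coeff-⊕ p q i) ⟩
      c * (coeff p i + coeff q i)              ≡⟨ ℤP.*-distribˡ-+ c (coeff p i) _ ⟩
      c * coeff p i + c * coeff q i
        ≡⟨ cong₂ _+_ (coeff-scale c p i) (coeff-scale c q i) ⟨
      coeff (scale c p) i + coeff (scale c q) i  ≡⟨ coeff-⊕ (scale c p) _ i ⟨
      coeff (scale c p ⊕ scale c q) i              ∎

    scale-distrib-+ : ∀ a b p → scale (a + b) p ≈ scale a p ⊕ scale b p
    scale-distrib-+ a b p = mk≈ λ i → begin
      coeff (scale (a + b) p) i                  ≡⟨ coeff-scale _ p i ⟩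
      (a + b) * coeff p i                      ≡⟨ ℤP.*-distribʳ-+ (coeff p i) a b ⟩
      a * coeff p i + b * coeff p i
        ≡⟨ cong₂ _+_ (coeff-scale a p i) (coeff-scale b p i) ⟨
      coeff (scale a p) i + coeff (scale b p) i  ≡⟨ coeff-⊕ (scale a p) _ i ⟨
      coeff (scale a p ⊕ scale b p) i              ∎

    scale-scale : ∀ a b p → scale a (scale b p) ≈ scale (a * b) p
    scale-scale a b p = mk≈ λ i → begin
      coeff (scale a (scale b p)) i   ≡⟨ coeff-scale a (scale b p) i ⟩
      a * coeff (scale b p) i       ≡⟨ cong (a *_) (coeff-scale b p i) ⟩
      a * (b * coeff p i)         ≡⟨ ℤP.*-assoc a b _ ⟨
      a * b * coeff p i           ≡⟨ coeff-scale (a * b) p i ⟨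
      coeff (scale (a * b) p) i     ∎

  ⊕-identityʳ : ∀ p → p ⊕ [] ≈ p
  ⊕-identityʳ p = mk≈ λ i → trans (coeff-⊕ p [] i) (ℤP.+-identityʳ _)

  scale-congˡ : ∀ {c d} p → c ≡ d → scale c p ≈ scale d p
  scale-congˡ p refl = ≈-refl

  scale-zeroˡ : ∀ p → scale (+ 0) p ≈ []
  scale-zeroˡ p = mk≈ λ i → trans (coeff-scale _ p i) (ℤP.*-zeroˡ (coeff p i))

  scale-identityˡ : ∀ p → scale (+ 1) p ≈ p
  scale-identityˡ p = mk≈ λ i → trans (coeff-scale _ p i) (ℤP.*-identityˡ (coeff p i))

  ∷-cong : ∀ {a b p q} → a ≡ b → p ≈ q → a ∷ p ≈ b ∷ q
  ∷-cong {a} {b} {p} {q} e f = mk≈ λ where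
    zero → e
    (suc i) → app f i

  ∷-injectiveʳ : ∀ {a b p q} → a ∷ p ≈ b ∷ q → p ≈ q
  ∷-injectiveʳ e = mk≈ λ i → app e (suc i)

  ∷≈[]⇒≈[] : ∀ {a p} → a ∷ p ≈ [] → p ≈ []
  ∷≈[]⇒≈[] e = mk≈ λ i → app e (suc i)

  0∷≈[] : ∀ {p} → p ≈ [] → + 0 ∷ p ≈ []
  0∷≈[] {p} e = mk≈ λ where
    zero → refl
    (suc i) → app e i

  const-≈[] : ∀ {z} → z ≡ + 0 → const z ≈ []
  const-≈[] e = ≈-trans (∷-cong e ≈-refl) (0∷≈[] ≈-refl)

  const-cong : ∀ {z w} → z ≡ w → const z ≈ const w
  const-cong e = ∷-cong e ≈-refl

  ⊗-zeroʳ : ∀ p → p ⊗ [] ≈ []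
  ⊗-zeroʳ [] = ≈-refl
  ⊗-zeroʳ (a ∷ p) = 0∷≈[] (⊗-zeroʳ p)

  ⊗-congʳ : ∀ p {q q′} → q ≈ q′ → p ⊗ q ≈ p ⊗ q′
  ⊗-congʳ [] e = ≈-refl
  ⊗-congʳ (a ∷ p) e = ⊕-cong (scale-cong a e) (∷-cong refl (⊗-congʳ p e))

  ≈[]⇒⊗≈[] : ∀ p q → p ≈ [] → p ⊗ q ≈ []
  ≈[]⇒⊗≈[] [] q e = ≈-refl
  ≈[]⇒⊗≈[] (a ∷ p) q e =
    ⊕-cong (≈-trans (scale-congˡ q (app e zero)) (scale-zeroˡ q))
           (0∷≈[] (≈[]⇒⊗≈[] p q (∷≈[]⇒≈[] e)))

  ⊗-congˡ : ∀ {p p′} q → p ≈ p′ → p ⊗ q ≈ p′ ⊗ q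
  ⊗-congˡ {[]} {p′} q e = ≈-sym (≈[]⇒⊗≈[] p′ q (≈-sym e))
  ⊗-congˡ {a ∷ p} {[]} q e = ≈[]⇒⊗≈[] (a ∷ p) q e
  ⊗-congˡ {a ∷ p} {b ∷ p′} q e =
    ⊕-cong (scale-congˡ q (app e zero)) (∷-cong refl (⊗-congˡ q (∷-injectiveʳ e)))

  ⊗-cong : ∀ {p p′ q q′} → p ≈ p′ → q ≈ q′ → p ⊗ q ≈ p′ ⊗ q′
  ⊗-cong {p′ = p′} {q = q} e f = ≈-trans (⊗-congˡ q e) (⊗-congʳ p′ f)

  0∷-⊗ : ∀ p q → (+ 0 ∷ p) ⊗ q ≈ + 0 ∷ (p ⊗ q)
  0∷-⊗ p q = ⊕-cong {q = + 0 ∷ (p ⊗ q)} (scale-zeroˡ q) ≈-refl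

  ⊗-distribʳ-⊕ : ∀ p p′ q → (p ⊕ p′) ⊗ q ≈ p ⊗ q ⊕ p′ ⊗ q
  ⊗-distribʳ-⊕ [] p′ q = ≈-refl
  ⊗-distribʳ-⊕ (a ∷ p) [] q = ≈-sym (⊕-identityʳ _)
  ⊗-distribʳ-⊕ (a ∷ p) (b ∷ p′) q =
    ≈-trans (⊕-cong (scale-distrib-+ a b q) (∷-cong refl (⊗-distribʳ-⊕ p p′ q)))
            (⊕-interchange (scale a q) (scale b q) (+ 0 ∷ (p ⊗ q)) (+ 0 ∷ (p′ ⊗ q)))

  ⊗-distribˡ-⊕ : ∀ p q q′ → p ⊗ (q ⊕ q′) ≈ p ⊗ q ⊕ p ⊗ q′
  ⊗-distribˡ-⊕ [] q q′ = ≈-refl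
  ⊗-distribˡ-⊕ (a ∷ p) q q′ =
    ≈-trans (⊕-cong (scale-distrib-⊕ a q q′) (∷-cong refl (⊗-distribˡ-⊕ p q q′)))
            (⊕-interchange (scale a q) (scale a q′) (+ 0 ∷ (p ⊗ q)) (+ 0 ∷ (p ⊗ q′)))

  scale-⊗ˡ : ∀ c p q → scale c (p ⊗ q) ≈ scale c p ⊗ q
  scale-⊗ˡ c [] q = ≈-refl
  scale-⊗ˡ c (a ∷ p) q =
    ≈-trans (scale-distrib-⊕ c (scale a q) _)
            (⊕-cong (scale-scale c a q) (∷-cong (ℤP.*-zeroʳ c) (scale-⊗ˡ c p q)))

  ⊕-lswap : ∀ x y z → x ⊕ (y ⊕ z) ≈ y ⊕ (x ⊕ z)
  ⊕-lswap x y z =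
    ≈-trans (≈-sym (⊕-assoc x y z)) (≈-trans (⊕-cong (⊕-comm x y) ≈-refl) (⊕-assoc y x z))

  ⊗-∷ʳ : ∀ q a p → q ⊗ (a ∷ p) ≈ scale a q ⊕ (+ 0 ∷ (q ⊗ p))
  ⊗-∷ʳ [] a p = ≈-sym (0∷≈[] ≈-refl)
  ⊗-∷ʳ (b ∷ q) a p =
    ∷-cong (cong (_+ + 0) (ℤP.*-comm b a))
      (≈-trans (⊕-cong {p = scale b p} ≈-refl (⊗-∷ʳ q a p)) (⊕-lswap (scale b p) (scale a q) _))

  ⊗-comm : ∀ p q → p ⊗ q ≈ q ⊗ p
  ⊗-comm [] q = ≈-sym (⊗-zeroʳ q)
  ⊗-comm (a ∷ p) q =
    ≈-trans (⊕-cong {p = scale a q} ≈-refl (∷-cong refl (⊗-comm p q))) (≈-sym (⊗-∷ʳ q a p))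

  ⊗-assoc : ∀ p q r → (p ⊗ q) ⊗ r ≈ p ⊗ (q ⊗ r)
  ⊗-assoc [] q r = ≈-refl
  ⊗-assoc (a ∷ p) q r =
    ≈-trans (⊗-distribʳ-⊕ (scale a q) (+ 0 ∷ (p ⊗ q)) r)
            (⊕-cong (≈-sym (scale-⊗ˡ a q r))
                    (≈-trans (0∷-⊗ (p ⊗ q) r) (∷-cong refl (⊗-assoc p q r))))

  ⊗-lswap : ∀ a s x → a ⊗ (s ⊗ x) ≈ s ⊗ (a ⊗ x)
  ⊗-lswap a s x =
    ≈-trans (≈-sym (⊗-assoc a s x)) (≈-trans (⊗-congˡ x (⊗-comm a s)) (⊗-assoc s a x))

  ⊗-interchange : ∀ a b c d → (a ⊗ b) ⊗ (c ⊗ d) ≈ (a ⊗ c) ⊗ (b ⊗ d)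
  ⊗-interchange a b c d =
    ≈-trans (⊗-assoc a b (c ⊗ d))
            (≈-trans (⊗-congʳ a (⊗-lswap b c d)) (≈-sym (⊗-assoc a c (b ⊗ d))))

  scale-⊗ʳ : ∀ c p q → scale c (p ⊗ q) ≈ p ⊗ scale c q
  scale-⊗ʳ c p q =
    ≈-trans (scale-cong c (⊗-comm p q)) (≈-trans (scale-⊗ˡ c q p) (⊗-comm (scale c q) p))

  const-⊗ : ∀ c p → const c ⊗ p ≈ scale c p
  const-⊗ c p = ≈-trans (⊕-cong {p = scale c p} ≈-refl (0∷≈[] ≈-refl)) (⊕-identityʳ (scale c p))

  one : Poly
  one = const (+ 1)

  ⊗-identityˡ : ∀ p → one ⊗ p ≈ p
  ⊗-identityˡ p = ≈-trans (const-⊗ (+ 1) p) (scale-identityˡ p)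

  ⊗-identityʳ : ∀ p → p ⊗ one ≈ p
  ⊗-identityʳ p = ≈-trans (⊗-comm p one) (⊗-identityˡ p)

  neg : Poly → Poly
  neg = scale (- + 1)

  neg-cong : ∀ {p q} → p ≈ q → neg p ≈ neg q
  neg-cong = scale-cong _

  neg-distrib-⊕ : ∀ p q → neg (p ⊕ q) ≈ neg p ⊕ neg q
  neg-distrib-⊕ = scale-distrib-⊕ _

  neg-involutive : ∀ p → neg (neg p) ≈ p
  neg-involutive p = ≈-trans (scale-scale _ _ p) (scale-identityˡ p)

  ⊕-inverseʳ : ∀ p → p ⊕ neg p ≈ []
  ⊕-inverseʳ p = mk≈ λ i →
    trans (coeff-⊕ p _ i)
          (trans (cong (λ z → coeff p i + z) (trans (coeff-scale _ p i) (ℤP.-1*i≡-i (coeff p i))))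
                 (ℤP.+-inverseʳ (coeff p i)))

  neg-one-⊗ : ∀ p → neg one ⊗ p ≈ neg p
  neg-one-⊗ = const-⊗ _

  ⊗-neg-one : ∀ p → p ⊗ neg one ≈ neg p
  ⊗-neg-one p = ≈-trans (≈-sym (scale-⊗ʳ (- + 1) p one)) (scale-cong (- + 1) (⊗-identityʳ p))

  -- Over ℤ, 2c = 0 forces c = 0: this is what makes a determinant with two equal rows vanish.
  ≈neg⇒≈[] : ∀ {p} → p ≈ neg p → p ≈ []
  ≈neg⇒≈[] {p} e = mk≈ λ i → self-negative (coeff p i) (trans (app e i) (trans (coeff-scale _ p i) (ℤP.-1*i≡-i _)))
    where
    self-negative : ∀ c → c ≡ - c → c ≡ + 0
    self-negative (+ zero) _ = refl
    self-negative (+ suc _) ()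
    self-negative ℤ.-[1+ _ ] ()

module Determinant where

  open PolyAlgebra
  open Booleans
  open import Data.Nat as ℕ using (ℕ; zero; suc)
  import Data.Nat.Properties as ℕP
  open import Data.Integer as ℤ using (+_; -_)
  import Data.Integer.Properties as ℤP
  open import Data.Integer.Solver using (module +-*-Solver)
  open import Data.Fin as Fin using (Fin; zero; suc; toℕ; punchIn)
  import Data.Fin.Properties as FinP
  open import Data.Bool using (Bool; true; false; if_then_else_; _∧_)
  open import Data.List using ([])
  open import Relation.Binary.PropositionalEquality
    using (_≡_; _≢_; refl; sym; trans; cong)
  open import Relation.Nullary using (yes; no)
  open import Relation.Nullary.Decidable using (⌊_⌋)
  open import Data.Empty using (⊥-elim)
  open import Function using (_∘_)

  module _ {n : ℕ} where

    eqFin-refl : (i : Fin n) → eqFin i i ≡ true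
    eqFin-refl i = ⌊⌋-yes (i Fin.≟ i) refl

    eqFin-≢ : {i j : Fin n} → i ≢ j → eqFin i j ≡ false
    eqFin-≢ = ⌊⌋-no (_ Fin.≟ _)

    eqFin-true⇒≡ : {i j : Fin n} → eqFin i j ≡ true → i ≡ j
    eqFin-true⇒≡ = ⌊⌋-true⇒ (_ Fin.≟ _)

    eqFin-false⇒≢ : {i j : Fin n} → eqFin i j ≡ false → i ≢ j
    eqFin-false⇒≢ = ⌊⌋-false⇒ (_ Fin.≟ _)

    eqFin-sym : (i j : Fin n) → eqFin i j ≡ eqFin j i
    eqFin-sym i j with i Fin.≟ j
    ... | yes refl = sym (eqFin-refl i)
    ... | no i≢j = sym (eqFin-≢ (i≢j ∘ sym))

  eqFin-suc : ∀ {n} (r c : Fin n) → eqFin (suc r) (suc c) ≡ eqFin r c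
  eqFin-suc r c with r Fin.≟ c
  ... | yes refl = refl
  ... | no _ = refl

  sumP-cong : ∀ n {f g : Fin n → Poly} → (∀ j → f j ≈ g j) → sumP n f ≈ sumP n g
  sumP-cong zero e = ≈-refl
  sumP-cong (suc n) e = ⊕-cong (e zero) (sumP-cong n (e ∘ suc))

  sumP-≈[] : ∀ n {f : Fin n → Poly} → (∀ j → f j ≈ []) → sumP n f ≈ []
  sumP-≈[] zero e = ≈-refl
  sumP-≈[] (suc n) e = ⊕-cong (e zero) (sumP-≈[] n (e ∘ suc))

  sumP-⊕ : ∀ n (f g : Fin n → Poly) → sumP n (λ j → f j ⊕ g j) ≈ sumP n f ⊕ sumP n g
  sumP-⊕ zero f g = ≈-refl
  sumP-⊕ (suc n) f g =
    ≈-trans (⊕-cong {p = f zero ⊕ g zero} ≈-refl (sumP-⊕ n (f ∘ suc) (g ∘ suc)))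
            (⊕-interchange (f zero) (g zero) _ _)

  ⊗-distrib-sumP : ∀ n c (f : Fin n → Poly) → c ⊗ sumP n f ≈ sumP n (λ j → c ⊗ f j)
  ⊗-distrib-sumP zero c f = ⊗-zeroʳ c
  ⊗-distrib-sumP (suc n) c f =
    ≈-trans (⊗-distribˡ-⊕ c (f zero) _)
            (⊕-cong {p = c ⊗ f zero} ≈-refl (⊗-distrib-sumP n c (f ∘ suc)))

  neg-sumP : ∀ n (f : Fin n → Poly) → neg (sumP n f) ≈ sumP n (λ j → neg (f j))
  neg-sumP zero f = ≈-refl
  neg-sumP (suc n) f =
    ≈-trans (neg-distrib-⊕ (f zero) _) (⊕-cong {p = neg (f zero)} ≈-refl (neg-sumP n (f ∘ suc)))

  sumP-extract : ∀ n (j : Fin (suc n)) (F : Fin (suc n) → Poly) →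
    sumP (suc n) F ≈ F j ⊕ sumP n (F ∘ punchIn j)
  sumP-extract n zero F = ≈-refl
  sumP-extract (suc n) (suc j) F =
    ≈-trans (⊕-cong {p = F zero} ≈-refl (sumP-extract n j (F ∘ suc)))
            (⊕-lswap (F zero) (F (suc j)) _)

  sumP-swap : ∀ n m (F : Fin n → Fin m → Poly) →
    sumP n (λ i → sumP m (F i)) ≈ sumP m (λ j → sumP n (λ i → F i j))
  sumP-swap zero m F = ≈-sym (sumP-≈[] m (λ j → ≈-refl))
  sumP-swap (suc n) m F =
    ≈-trans (⊕-cong {p = sumP m (F zero)} ≈-refl (sumP-swap n m (F ∘ suc)))
            (≈-sym (sumP-⊕ m (F zero) (λ j → sumP n (λ i → F (suc i) j))))

  sumP-single : ∀ n (i : Fin n) (f : Fin n → Poly) (v : Poly) →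
    (∀ k → f k ≈ (if eqFin k i then v else [])) → sumP n f ≈ v
  sumP-single (suc n) i f v h =
    ≈-trans (sumP-extract n i f)
      (≈-trans (⊕-cong (at-i (h i)) (sumP-≈[] n off-i)) (⊕-identityʳ v))
    where
    at-i : f i ≈ (if eqFin i i then v else []) → f i ≈ v
    at-i e rewrite eqFin-refl i = e
    off-i : ∀ k → f (punchIn i k) ≈ []
    off-i k = ≈-trans (h (punchIn i k))
      (≈-reflexive (cong (if_then v else []) (eqFin-≢ (FinP.punchInᵢ≢i i k))))

  Mat : ℕ → Set
  Mat n = Fin n → Fin n → Poly

  sign : ∀ {n} → Fin n → Poly
  sign j = const (alt (toℕ j))

  minor : ∀ {n} → Mat (suc n) → Fin (suc n) → Mat n
  minor M j r c = M (suc r) (punchIn j c)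

  cofactorTerm : ∀ {n} → Mat (suc n) → Fin (suc n) → Poly
  cofactorTerm {n} M j = sign j ⊗ M zero j ⊗ det n (minor M j)

  det-cong : ∀ n {M M′ : Mat n} → (∀ i j → M i j ≈ M′ i j) → det n M ≈ det n M′
  det-cong zero e = ≈-refl
  det-cong (suc n) e = sumP-cong (suc n) λ j →
    ⊗-cong (⊗-cong (≈-refl {sign j}) (e zero j)) (det-cong n (λ r c → e (suc r) (punchIn j c)))

  det-additive-row : ∀ n (i : Fin n) (A B C : Mat n) →
    (∀ r c → r ≢ i → C r c ≈ A r c) → (∀ r c → r ≢ i → C r c ≈ B r c) →
    (∀ c → C i c ≈ A i c ⊕ B i c) → det n C ≈ det n A ⊕ det n B
  det-additive-row (suc n) zero A B C hA hB hi =
    ≈-trans (sumP-cong (suc n) term) (sumP-⊕ (suc n) (cofactorTerm A) (cofactorTerm B))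
    where
    term : ∀ j → cofactorTerm C j ≈ cofactorTerm A j ⊕ cofactorTerm B j
    term j =
      ≈-trans (⊗-congˡ (det n (minor C j))
                (≈-trans (⊗-congʳ (sign j) (hi j)) (⊗-distribˡ-⊕ (sign j) (A zero j) (B zero j))))
      (≈-trans (⊗-distribʳ-⊕ (sign j ⊗ A zero j) (sign j ⊗ B zero j) (det n (minor C j)))
      (⊕-cong (⊗-congʳ (sign j ⊗ A zero j) (det-cong n (λ r c → hA (suc r) (punchIn j c) (λ ()))))
              (⊗-congʳ (sign j ⊗ B zero j) (det-cong n (λ r c → hB (suc r) (punchIn j c) (λ ()))))))
  det-additive-row (suc n) (suc i) A B C hA hB hi =
    ≈-trans (sumP-cong (suc n) term) (sumP-⊕ (suc n) (cofactorTerm A) (cofactorTerm B))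
    where
    minors : ∀ j → det n (minor C j) ≈ det n (minor A j) ⊕ det n (minor B j)
    minors j = det-additive-row n i (minor A j) (minor B j) (minor C j)
      (λ r c r≢i → hA (suc r) (punchIn j c) (r≢i ∘ FinP.suc-injective))
      (λ r c r≢i → hB (suc r) (punchIn j c) (r≢i ∘ FinP.suc-injective))
      (hi ∘ punchIn j)
    term : ∀ j → cofactorTerm C j ≈ cofactorTerm A j ⊕ cofactorTerm B j
    term j =
      ≈-trans (⊗-congʳ (sign j ⊗ C zero j) (minors j))
      (≈-trans (⊗-distribˡ-⊕ (sign j ⊗ C zero j) (det n (minor A j)) (det n (minor B j)))
      (⊕-cong (⊗-congˡ (det n (minor A j)) (⊗-congʳ (sign j) (hA zero j (λ ()))))
              (⊗-congˡ (det n (minor B j)) (⊗-congʳ (sign j) (hB zero j (λ ()))))))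

  det-homogeneous-row : ∀ n (i : Fin n) (s : Poly) (A C : Mat n) →
    (∀ r c → r ≢ i → C r c ≈ A r c) → (∀ c → C i c ≈ s ⊗ A i c) → det n C ≈ s ⊗ det n A
  det-homogeneous-row (suc n) zero s A C hA hi =
    ≈-trans (sumP-cong (suc n) term) (≈-sym (⊗-distrib-sumP (suc n) s (cofactorTerm A)))
    where
    term : ∀ j → cofactorTerm C j ≈ s ⊗ cofactorTerm A j
    term j =
      ≈-trans (⊗-cong (≈-trans (⊗-congʳ (sign j) (hi j)) (⊗-lswap (sign j) s (A zero j)))
                      (det-cong n (λ r c → hA (suc r) (punchIn j c) (λ ()))))
              (⊗-assoc s (sign j ⊗ A zero j) (det n (minor A j)))
  det-homogeneous-row (suc n) (suc i) s A C hA hi =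
    ≈-trans (sumP-cong (suc n) term) (≈-sym (⊗-distrib-sumP (suc n) s (cofactorTerm A)))
    where
    minors : ∀ j → det n (minor C j) ≈ s ⊗ det n (minor A j)
    minors j = det-homogeneous-row n i s (minor A j) (minor C j)
      (λ r c r≢i → hA (suc r) (punchIn j c) (r≢i ∘ FinP.suc-injective)) (hi ∘ punchIn j)
    term : ∀ j → cofactorTerm C j ≈ s ⊗ cofactorTerm A j
    term j = ≈-trans (⊗-cong (⊗-congʳ (sign j) (hA zero j (λ ()))) (minors j))
                     (⊗-lswap (sign j ⊗ A zero j) s (det n (minor A j)))

  det-zero-row : ∀ n (i : Fin n) (M : Mat n) → (∀ c → M i c ≈ []) → det n M ≈ []
  det-zero-row n i M h = det-homogeneous-row n i [] M M (λ r c _ → ≈-refl) h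

  -- The position of c among the indices other than j: a total punchOut, with junk value at c = j.
  punchOut′ : ∀ {m} → Fin (suc (suc m)) → Fin (suc (suc m)) → Fin (suc m)
  punchOut′ zero zero = zero
  punchOut′ zero (suc c) = c
  punchOut′ (suc j) zero = zero
  punchOut′ {zero} (suc j) (suc c) = zero
  punchOut′ {suc m} (suc j) (suc c) = suc (punchOut′ j c)

  punchOut′-punchIn : ∀ {m} (j : Fin (suc (suc m))) (k : Fin (suc m)) → punchOut′ j (punchIn j k) ≡ k
  punchOut′-punchIn zero k = refl
  punchOut′-punchIn (suc j) zero = refl
  punchOut′-punchIn {suc m} (suc j) (suc k) = cong suc (punchOut′-punchIn j k)

  punchIn-punchOut′-comm : ∀ {m} (j c : Fin (suc (suc m))) → j ≢ c → (d : Fin m) →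
    punchIn j (punchIn (punchOut′ j c) d) ≡ punchIn c (punchIn (punchOut′ c j) d)
  punchIn-punchOut′-comm zero zero j≢c d = ⊥-elim (j≢c refl)
  punchIn-punchOut′-comm zero (suc c) j≢c d = refl
  punchIn-punchOut′-comm (suc j) zero j≢c d = refl
  punchIn-punchOut′-comm {suc m} (suc j) (suc c) j≢c zero = refl
  punchIn-punchOut′-comm {suc m} (suc j) (suc c) j≢c (suc d) =
    cong suc (punchIn-punchOut′-comm j c (j≢c ∘ cong suc) d)

  alt-transposition : ∀ {m} (j c : Fin (suc (suc m))) → j ≢ c →
    alt (toℕ j) ℤ.* alt (toℕ (punchOut′ j c)) ≡ - (alt (toℕ c) ℤ.* alt (toℕ (punchOut′ c j)))
  alt-transposition zero zero j≢c = ⊥-elim (j≢c refl)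
  alt-transposition zero (suc c) _ = solve 1 (λ a → con (+ 1) :* a := :- ((:- a) :* con (+ 1))) refl _
    where open +-*-Solver
  alt-transposition (suc j) zero _ = solve 1 (λ a → (:- a) :* con (+ 1) := :- (con (+ 1) :* a)) refl _
    where open +-*-Solver
  alt-transposition {zero} (suc zero) (suc zero) j≢c = ⊥-elim (j≢c refl)
  alt-transposition {suc m} (suc j) (suc c) j≢c =
    trans (neg*neg (alt (toℕ j)) (alt (toℕ (punchOut′ j c))))
          (trans (alt-transposition j c (j≢c ∘ cong suc))
                 (cong -_ (sym (neg*neg (alt (toℕ c)) (alt (toℕ (punchOut′ c j)))))))
    where
    open +-*-Solver
    neg*neg : ∀ a b → (- a) ℤ.* (- b) ≡ a ℤ.* b
    neg*neg = solve 2 (λ a b → (:- a) :* (:- b) := a :* b) refl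

  -- Expanding along the first two rows R₀, R₁ gives a double sum over pairs of distinct columns
  -- (j , c); exchanging the roles of j and c exhibits the sign change under R₀ ↔ R₁.
  module FirstTwoRows (m : ℕ) (Rest : Fin m → Fin (suc (suc m)) → Poly) where

    Row : Set
    Row = Fin (suc (suc m)) → Poly

    secondRowTerm : Row → Fin (suc (suc m)) → Fin (suc m) → Poly
    secondRowTerm R₁ j k = sign k ⊗ R₁ (punchIn j k) ⊗ det m (λ r e → Rest r (punchIn j (punchIn k e)))

    expansion : Row → Row → Poly
    expansion R₀ R₁ = sumP (suc (suc m)) (λ j → sign j ⊗ R₀ j ⊗ sumP (suc m) (secondRowTerm R₁ j))

    rest : Fin (suc (suc m)) → Fin (suc (suc m)) → Poly
    rest j c = det m (λ r e → Rest r (punchIn j (punchIn (punchOut′ j c) e)))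

    pairTerm : Row → Row → Fin (suc (suc m)) → Fin (suc (suc m)) → Poly
    pairTerm R₀ R₁ j c =
      if eqFin j c then [] else (sign j ⊗ R₀ j) ⊗ (sign (punchOut′ j c) ⊗ R₁ c ⊗ rest j c)

    expansion-pairs : ∀ R₀ R₁ j →
      sign j ⊗ R₀ j ⊗ sumP (suc m) (secondRowTerm R₁ j) ≈ sumP (suc (suc m)) (pairTerm R₀ R₁ j)
    expansion-pairs R₀ R₁ j =
      ≈-trans (⊗-distrib-sumP (suc m) (sign j ⊗ R₀ j) (secondRowTerm R₁ j))
              (≈-sym (≈-trans (sumP-extract (suc m) j (pairTerm R₀ R₁ j))
                              (⊕-cong diagonal (sumP-cong (suc m) offDiagonal))))
      where
      diagonal : pairTerm R₀ R₁ j j ≈ []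
      diagonal rewrite eqFin-refl j = ≈-refl
      offDiagonal : ∀ k → pairTerm R₀ R₁ j (punchIn j k) ≈ (sign j ⊗ R₀ j) ⊗ secondRowTerm R₁ j k
      offDiagonal k rewrite eqFin-≢ (FinP.punchInᵢ≢i j k ∘ sym) | punchOut′-punchIn j k = ≈-refl

    const-rearrange : ∀ a b x y d →
      (const a ⊗ x) ⊗ ((const b ⊗ y) ⊗ d) ≈ scale (a ℤ.* b) (x ⊗ (y ⊗ d))
    const-rearrange a b x y d =
      ≈-trans (⊗-cong (const-⊗ a x) (≈-trans (⊗-congˡ d (const-⊗ b y)) (≈-sym (scale-⊗ˡ b y d))))
      (≈-trans (≈-sym (scale-⊗ˡ a x _))
      (≈-trans (scale-cong a (≈-sym (scale-⊗ʳ b x (y ⊗ d)))) (scale-scale a b _)))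

    pairTerm-antisym : ∀ R₀ R₁ j c → pairTerm R₀ R₁ j c ≈ neg (pairTerm R₁ R₀ c j)
    pairTerm-antisym R₀ R₁ j c with j Fin.≟ c
    ... | yes refl rewrite eqFin-refl j = ≈-refl
    ... | no j≢c rewrite eqFin-≢ (j≢c ∘ sym) =
      ≈-trans (const-rearrange (alt (toℕ j)) (alt (toℕ (punchOut′ j c))) (R₀ j) (R₁ c) (rest j c))
      (≈-trans (scale-congˡ _ (alt-transposition j c j≢c))
      (≈-trans (scale-cong _ (≈-trans (⊗-lswap (R₀ j) (R₁ c) (rest j c))
                 (⊗-congʳ (R₁ c) (⊗-congʳ (R₀ j) (det-cong m λ r e →
                   ≈-reflexive (cong (Rest r) (punchIn-punchOut′-comm j c j≢c e)))))))
      (≈-trans (scale-congˡ _ (sym (ℤP.-1*i≡-i (alt (toℕ c) ℤ.* alt (toℕ (punchOut′ c j))))))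
      (≈-trans (≈-sym (scale-scale (- + 1) (alt (toℕ c) ℤ.* alt (toℕ (punchOut′ c j))) _))
      (neg-cong (≈-sym (const-rearrange (alt (toℕ c)) (alt (toℕ (punchOut′ c j))) (R₁ c) (R₀ j) (rest c j))))))))

    expansion-antisym : ∀ R₀ R₁ → expansion R₀ R₁ ≈ neg (expansion R₁ R₀)
    expansion-antisym R₀ R₁ =
      ≈-trans (sumP-cong (suc (suc m)) (expansion-pairs R₀ R₁))
      (≈-trans (sumP-swap (suc (suc m)) (suc (suc m)) (pairTerm R₀ R₁))
      (≈-trans (sumP-cong (suc (suc m)) (λ c → ≈-trans
                 (sumP-cong (suc (suc m)) (λ j → pairTerm-antisym R₀ R₁ j c))
                 (≈-sym (neg-sumP (suc (suc m)) (pairTerm R₁ R₀ c)))))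
      (≈-trans (≈-sym (neg-sumP (suc (suc m)) (λ c → sumP (suc (suc m)) (pairTerm R₁ R₀ c))))
      (neg-cong (≈-sym (sumP-cong (suc (suc m)) (expansion-pairs R₁ R₀)))))))

  swap₀₁ : ∀ {m} → Mat (suc (suc m)) → Mat (suc (suc m))
  swap₀₁ M zero = M (suc zero)
  swap₀₁ M (suc zero) = M zero
  swap₀₁ M (suc (suc r)) = M (suc (suc r))

  det-swap₀₁ : ∀ m (M : Mat (suc (suc m))) → det (suc (suc m)) (swap₀₁ M) ≈ neg (det (suc (suc m)) M)
  det-swap₀₁ m M = FirstTwoRows.expansion-antisym m (λ r → M (suc (suc r))) (M (suc zero)) (M zero)

  mutual
    det-equal-rows : ∀ n (i k : Fin n) → i ≢ k → (M : Mat n) → (∀ c → M i c ≈ M k c) → det n M ≈ []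
    det-equal-rows (suc n) zero k 0≢k M h = det-equal-first-row n k 0≢k M h
    det-equal-rows (suc n) (suc i) zero i≢0 M h = det-equal-first-row n (suc i) (i≢0 ∘ sym) M (≈-sym ∘ h)
    det-equal-rows (suc n) (suc i) (suc k) i≢k M h = det-equal-lower-rows n i k (i≢k ∘ cong suc) M h

    det-equal-lower-rows : ∀ n (i k : Fin n) → i ≢ k → (M : Mat (suc n)) →
      (∀ c → M (suc i) c ≈ M (suc k) c) → det (suc n) M ≈ []
    det-equal-lower-rows n i k i≢k M h = sumP-≈[] (suc n) λ j →
      ≈-trans (⊗-congʳ (sign j ⊗ M zero j) (det-equal-rows n i k i≢k (minor M j) (h ∘ punchIn j)))
              (⊗-zeroʳ (sign j ⊗ M zero j))

    -- Swapping rows 0 and 1 either fixes M (k = 1), or moves the coincidence below row 0.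
    det-equal-first-row : ∀ n (k : Fin (suc n)) → zero ≢ k → (M : Mat (suc n)) →
      (∀ c → M zero c ≈ M k c) → det (suc n) M ≈ []
    det-equal-first-row n zero 0≢0 M h = ⊥-elim (0≢0 refl)
    det-equal-first-row (suc m) (suc zero) _ M h =
      ≈neg⇒≈[] (≈-trans (det-cong (suc (suc m)) swap≈) (det-swap₀₁ m M))
      where
      swap≈ : ∀ r c → M r c ≈ swap₀₁ M r c
      swap≈ zero c = h c
      swap≈ (suc zero) c = ≈-sym (h c)
      swap≈ (suc (suc r)) c = ≈-refl
    det-equal-first-row (suc m) (suc (suc k)) _ M h =
      ≈-trans (≈-sym (neg-involutive (det (suc (suc m)) M)))
      (≈-trans (neg-cong (≈-sym (det-swap₀₁ m M)))
               (neg-cong (det-equal-lower-rows (suc m) zero (suc k) (λ ()) (swap₀₁ M) h)))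

  setRow : ∀ {n} → Mat n → Fin n → (Fin n → Poly) → Mat n
  setRow M i v r c = if eqFin r i then v c else M r c

  setRow-≢ : ∀ {n} (M : Mat n) i v r c → r ≢ i → setRow M i v r c ≈ M r c
  setRow-≢ M i v r c r≢i rewrite eqFin-≢ r≢i = ≈-refl

  setRow-≡ : ∀ {n} (M : Mat n) i v c → setRow M i v i c ≈ v c
  setRow-≡ M i v c rewrite eqFin-refl i = ≈-refl

  det-sum-row : ∀ n (i : Fin n) (M : Mat n) m (F : Fin m → Fin n → Poly) (C : Mat n) →
    (∀ r c → r ≢ i → C r c ≈ M r c) → (∀ c → C i c ≈ sumP m (λ k → F k c)) →
    det n C ≈ sumP m (λ k → det n (setRow M i (F k)))
  det-sum-row n i M zero F C hr hi = det-zero-row n i C hi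
  det-sum-row n i M (suc m) F C hr hi =
    ≈-trans (det-additive-row n i (setRow M i (F zero)) B C
              (λ r c r≢i → ≈-trans (hr r c r≢i) (≈-sym (setRow-≢ M i (F zero) r c r≢i)))
              (λ r c r≢i → ≈-trans (hr r c r≢i) (≈-sym (setRow-≢ M i rest r c r≢i)))
              (λ c → ≈-trans (hi c) (⊕-cong (≈-sym (setRow-≡ M i (F zero) c)) (≈-sym (setRow-≡ M i rest c)))))
    (⊕-cong {p = det n (setRow M i (F zero))} ≈-refl
       (det-sum-row n i M m (F ∘ suc) B (setRow-≢ M i rest) (setRow-≡ M i rest)))
    where
    rest : Fin n → Poly
    rest c = sumP m (λ k → F (suc k) c)
    B : Mat n
    B = setRow M i rest

  det-row-combination : ∀ n (i : Fin n) (M C : Mat n) (a : Fin n → Poly) → a i ≈ [] →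
    (∀ r c → r ≢ i → C r c ≈ M r c) →
    (∀ c → C i c ≈ M i c ⊕ sumP n (λ k → a k ⊗ M k c)) → det n C ≈ det n M
  det-row-combination n i M C a aᵢ≈[] hr hi =
    ≈-trans (det-additive-row n i M B C hr (λ r c r≢i → ≈-trans (hr r c r≢i) (≈-sym (setRow-≢ M i combo r c r≢i)))
              (λ c → ≈-trans (hi c) (⊕-cong {p = M i c} ≈-refl (≈-sym (setRow-≡ M i combo c)))))
    (≈-trans (⊕-cong {p = det n M} ≈-refl detB) (⊕-identityʳ (det n M)))
    where
    combo : Fin n → Poly
    combo c = sumP n (λ k → a k ⊗ M k c)
    B : Mat n
    B = setRow M i combo
    copy-vanishes : ∀ k → a k ⊗ det n (setRow M i (M k)) ≈ []
    copy-vanishes k with k Fin.≟ i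
    ... | yes refl = ≈[]⇒⊗≈[] (a k) _ aᵢ≈[]
    ... | no k≢i = ≈-trans (⊗-congʳ (a k) (det-equal-rows n i k (k≢i ∘ sym) (setRow M i (M k))
                    (λ c → ≈-trans (setRow-≡ M i (M k) c) (≈-sym (setRow-≢ M i (M k) k c k≢i)))))
                    (⊗-zeroʳ (a k))
    term : ∀ k → det n (setRow M i (λ c → a k ⊗ M k c)) ≈ []
    term k = ≈-trans
      (det-homogeneous-row n i (a k) (setRow M i (M k)) (setRow M i (λ c → a k ⊗ M k c))
        (λ r c r≢i → ≈-trans (setRow-≢ M i scaled r c r≢i) (≈-sym (setRow-≢ M i (M k) r c r≢i)))
        (λ c → ≈-trans (setRow-≡ M i scaled c) (⊗-congʳ (a k) (≈-sym (setRow-≡ M i (M k) c)))))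
      (copy-vanishes k)
      where
      scaled : Fin n → Poly
      scaled c = a k ⊗ M k c
    detB : det n B ≈ []
    detB = ≈-trans (det-sum-row n i M n (λ k c → a k ⊗ M k c) B (setRow-≢ M i combo) (setRow-≡ M i combo))
                   (sumP-≈[] n term)

  prodP : (n : ℕ) → (Fin n → Poly) → Poly
  prodP zero f = one
  prodP (suc n) f = f zero ⊗ prodP n (f ∘ suc)

  prodP-cong : ∀ n {f g : Fin n → Poly} → (∀ j → f j ≈ g j) → prodP n f ≈ prodP n g
  prodP-cong zero e = ≈-refl
  prodP-cong (suc n) e = ⊗-cong (e zero) (prodP-cong n (e ∘ suc))

  prodP-⊗ : ∀ n (f g : Fin n → Poly) → prodP n f ⊗ prodP n g ≈ prodP n (λ j → f j ⊗ g j)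
  prodP-⊗ zero f g = ⊗-identityˡ one
  prodP-⊗ (suc n) f g = ≈-trans (⊗-interchange (f zero) _ (g zero) _)
    (⊗-congʳ (f zero ⊗ g zero) (prodP-⊗ n (f ∘ suc) (g ∘ suc)))

  det-scale-rows : ∀ n (S : Fin n → Bool) (f : Fin n → Poly) (M M′ : Mat n) →
    (∀ r c → S r ≡ true → M r c ≈ f r ⊗ M′ r c) → (∀ r c → S r ≡ false → M r c ≈ M′ r c) →
    det n M ≈ prodP n (λ r → if S r then f r else one) ⊗ det n M′
  det-scale-rows zero S f M M′ h₁ h₀ = ≈-sym (⊗-identityˡ one)
  det-scale-rows (suc n) S f M M′ h₁ h₀ =
    ≈-trans (sumP-cong (suc n) term) (≈-sym (⊗-distrib-sumP (suc n) (g₀ ⊗ lower) (cofactorTerm M′)))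
    where
    g₀ : Poly
    g₀ = if S zero then f zero else one
    lower : Poly
    lower = prodP n (λ r → if S (suc r) then f (suc r) else one)
    row₀ : ∀ j → M zero j ≈ g₀ ⊗ M′ zero j
    row₀ j with S zero in eq
    ... | true = h₁ zero j eq
    ... | false = ≈-trans (h₀ zero j eq) (≈-sym (⊗-identityˡ _))
    minors : ∀ j → det n (minor M j) ≈ lower ⊗ det n (minor M′ j)
    minors j = det-scale-rows n (S ∘ suc) (f ∘ suc) (minor M j) (minor M′ j)
      (λ r c → h₁ (suc r) (punchIn j c)) (λ r c → h₀ (suc r) (punchIn j c))
    rearrange : ∀ a g x p d → (a ⊗ (g ⊗ x)) ⊗ (p ⊗ d) ≈ (g ⊗ p) ⊗ ((a ⊗ x) ⊗ d)
    rearrange a g x p d =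
      ≈-trans (⊗-congˡ (p ⊗ d) (⊗-lswap a g x)) (⊗-interchange g (a ⊗ x) p d)
    term : ∀ j → cofactorTerm M j ≈ (g₀ ⊗ lower) ⊗ cofactorTerm M′ j
    term j = ≈-trans (⊗-cong (⊗-congʳ (sign j) (row₀ j)) (minors j))
                     (rearrange (sign j) g₀ (M′ zero j) lower (det n (minor M′ j)))

  identity : ∀ n → Mat n
  identity n r c = if eqFin r c then one else []

  det-identity : ∀ n → det n (identity n) ≈ one
  det-identity zero = ≈-refl
  det-identity (suc n) = ≈-trans (⊕-cong diagonal (sumP-≈[] n offDiagonal)) (⊕-identityʳ one)
    where
    minor-identity : ∀ r c → minor (identity (suc n)) zero r c ≈ identity n r c
    minor-identity r c = ≈-reflexive (cong (if_then one else []) (eqFin-suc r c))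
    diagonal : cofactorTerm (identity (suc n)) zero ≈ one
    diagonal =
      ≈-trans (⊗-congʳ (sign {suc n} zero ⊗ one)
                (≈-trans (det-cong n minor-identity) (det-identity n)))
      (≈-trans (⊗-identityʳ _) (⊗-identityˡ one))
    offDiagonal : ∀ k → cofactorTerm (identity (suc n)) (suc k) ≈ []
    offDiagonal k = ≈[]⇒⊗≈[] (sign (suc k) ⊗ []) _ (⊗-zeroʳ (sign (suc k)))

  _<ᶠ_ : ∀ {n} → Fin n → ℕ → Bool
  r <ᶠ m = ⌊ toℕ r ℕ.<? m ⌋

  <ᶠ-suc-≢ : ∀ {n} m (r : Fin n) → toℕ r ≢ m → r <ᶠ suc m ≡ r <ᶠ m
  <ᶠ-suc-≢ m r ne with toℕ r ℕ.<? suc m | toℕ r ℕ.<? m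
  ... | yes _ | yes _ = refl
  ... | no _ | no _ = refl
  ... | yes p | no q = ⊥-elim (q (ℕP.≤∧≢⇒< (ℕP.≤-pred p) ne))
  ... | no p | yes q = ⊥-elim (p (ℕP.m≤n⇒m≤1+n q))

  <ᶠ-suc-≡ : ∀ {n} m (r : Fin n) → toℕ r ≡ m → r <ᶠ suc m ≡ true
  <ᶠ-suc-≡ m r e = ⌊⌋-yes (toℕ r ℕ.<? suc m) (ℕ.s≤s (ℕP.≤-reflexive e))

  <ᶠ-≡ : ∀ {n} m (r : Fin n) → toℕ r ≡ m → r <ᶠ m ≡ false
  <ᶠ-≡ m r e = ⌊⌋-no (toℕ r ℕ.<? m) (ℕP.<-irrefl e)

  <ᶠ-≥ : ∀ {n} m (r : Fin n) → n ℕ.≤ m → r <ᶠ m ≡ true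
  <ᶠ-≥ m r le = ⌊⌋-yes (toℕ r ℕ.<? m) (ℕP.<-≤-trans (FinP.toℕ<n r) le)

  -- Each selected row (S r) receives a combination of unselected rows; since those stay
  -- fixed, the row operations can be performed one row at a time, in increasing order.
  module RowCombinations (n : ℕ) (S : Fin n → Bool) (a : Fin n → Fin n → Poly) (M C : Mat n)
    (a-unselected : ∀ i k → S k ≡ true → a i k ≈ [])
    (C-unselected : ∀ r c → S r ≡ false → C r c ≈ M r c)
    (C-selected : ∀ r c → S r ≡ true → C r c ≈ M r c ⊕ sumP n (λ k → a r k ⊗ M k c)) where

    stage : ℕ → Mat n
    stage m r c = if S r ∧ r <ᶠ m then C r c else M r c

    stage-stable : ∀ m r → r <ᶠ suc m ≡ r <ᶠ m → ∀ c → stage (suc m) r c ≈ stage m r c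
    stage-stable m r e c rewrite e = ≈-refl

    stage-unselected : ∀ m r → S r ≡ false → ∀ c → stage m r c ≈ M r c
    stage-unselected m r e c rewrite e = ≈-refl

    det-next-stage : ∀ m → det n (stage (suc m)) ≈ det n (stage m)
    det-next-stage m with m ℕ.<? n
    ... | no m≮n = det-cong n λ r c → stage-stable m r
            (trans (<ᶠ-≥ (suc m) r (ℕP.m≤n⇒m≤1+n (ℕP.≮⇒≥ m≮n))) (sym (<ᶠ-≥ m r (ℕP.≮⇒≥ m≮n)))) c
    ... | yes m<n with S (Fin.fromℕ< m<n) in Sᵢ
    ...   | true = det-row-combination n i (stage m) (stage (suc m)) (a i) (a-unselected i i Sᵢ) others row-i
      where
      i = Fin.fromℕ< m<n
      toℕ-i : toℕ i ≡ m
      toℕ-i = FinP.toℕ-fromℕ< m<n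
      others : ∀ r c → r ≢ i → stage (suc m) r c ≈ stage m r c
      others r c r≢i = stage-stable m r (<ᶠ-suc-≢ m r (λ e → r≢i (FinP.toℕ-injective (trans e (sym toℕ-i))))) c
      combination : ∀ c k → a i k ⊗ M k c ≈ a i k ⊗ stage m k c
      combination c k with S k in Sₖ
      ... | true = ≈-trans (≈[]⇒⊗≈[] (a i k) (M k c) (a-unselected i k Sₖ))
                           (≈-sym (≈[]⇒⊗≈[] (a i k) _ (a-unselected i k Sₖ)))
      ... | false = ≈-refl
      row-i : ∀ c → stage (suc m) i c ≈ stage m i c ⊕ sumP n (λ k → a i k ⊗ stage m k c)
      row-i c rewrite Sᵢ | <ᶠ-suc-≡ m i toℕ-i | <ᶠ-≡ m i toℕ-i =
        ≈-trans (C-selected i c Sᵢ) (⊕-cong {p = M i c} ≈-refl (sumP-cong n (combination c)))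
    ...   | false = det-cong n same
      where
      i = Fin.fromℕ< m<n
      same : ∀ r c → stage (suc m) r c ≈ stage m r c
      same r c with r Fin.≟ i
      ... | yes refl = ≈-trans (stage-unselected (suc m) r Sᵢ c) (≈-sym (stage-unselected m r Sᵢ c))
      ... | no r≢i = stage-stable m r (<ᶠ-suc-≢ m r λ e →
                       r≢i (FinP.toℕ-injective (trans e (sym (FinP.toℕ-fromℕ< m<n))))) c

    det-stage : ∀ m → det n (stage m) ≈ det n M
    det-stage zero = det-cong n initial
      where
      initial : ∀ r c → stage zero r c ≈ M r c
      initial r c with S r
      ... | true = ≈-refl
      ... | false = ≈-refl
    det-stage (suc m) = ≈-trans (det-next-stage m) (det-stage m)

    det-C : det n C ≈ det n M
    det-C = ≈-trans (det-cong n final) (det-stage n)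
      where
      final : ∀ r c → C r c ≈ stage n r c
      final r c rewrite <ᶠ-≥ n r ℕP.≤-refl with S r in e
      ... | true = ≈-refl
      ... | false = C-unselected r c e

  det-row-combinations : ∀ n (S : Fin n → Bool) (a : Fin n → Fin n → Poly) (M C : Mat n) →
    (∀ i k → S k ≡ true → a i k ≈ []) →
    (∀ r c → S r ≡ false → C r c ≈ M r c) →
    (∀ r c → S r ≡ true → C r c ≈ M r c ⊕ sumP n (λ k → a r k ⊗ M k c)) →
    det n C ≈ det n M
  det-row-combinations n S a M C = RowCombinations.det-C n S a M C

module Multipartite where

  open PolyAlgebra
  open Determinant
  open Booleans
  open import Data.Nat as ℕ using (ℕ; zero; suc)
  import Data.Nat.Properties as ℕP
  open import Data.Integer as ℤ using (ℤ; +_; -_)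
  import Data.Integer.Properties as ℤP
  open import Data.Integer.Solver using (module +-*-Solver)
  open import Data.Fin as Fin using (Fin; zero; suc; punchIn)
  import Data.Fin.Properties as FinP
  open import Data.Bool using (Bool; true; false; if_then_else_; not; _∧_)
  import Data.Bool.Properties as BoolP
  open import Data.List using ([]; _∷_)
  open import Data.Maybe as Maybe using (Maybe; just; nothing; fromMaybe)
  open import Data.Product using (Σ; _×_; _,_; proj₁; proj₂)
  open import Relation.Binary.PropositionalEquality
    using (_≡_; _≢_; refl; sym; trans; cong; cong₂; module ≡-Reasoning)
  open import Relation.Nullary using (yes; no)
  open import Relation.Nullary.Decidable using (⌊_⌋)
  open import Data.Empty using (⊥-elim)
  open import Function using (_∘_)
  open import Algebra.Properties.Semiring.Sum ℕP.+-*-semiring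
    using (sum; sum-cong-≗; ∑-distrib-+; ∑-comm; sum-remove; sum-replicate-zero)

  sum-const-1 : ∀ n → sum {n} (λ _ → 1) ≡ n
  sum-const-1 zero = refl
  sum-const-1 (suc n) = cong suc (sum-const-1 n)

  sum-≡0 : ∀ n (f : Fin n → ℕ) → (∀ j → f j ≡ 0) → sum f ≡ 0
  sum-≡0 n f h = trans (sum-cong-≗ h) (sum-replicate-zero n)

  sum-single : ∀ n (i : Fin n) (v : ℕ) → sum {n} (λ j → if eqFin j i then v else 0) ≡ v
  sum-single (suc n) i v = begin
    sum f                            ≡⟨ sum-remove {i = i} f ⟩
    f i ℕ.+ sum (f ∘ punchIn i)      ≡⟨ cong₂ ℕ._+_ at-i (sum-≡0 n _ off-i) ⟩
    v ℕ.+ 0                          ≡⟨ ℕP.+-identityʳ v ⟩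
    v                                ∎
    where
    open ≡-Reasoning
    f : Fin (suc n) → ℕ
    f j = if eqFin j i then v else 0
    at-i : f i ≡ v
    at-i rewrite eqFin-refl i = refl
    off-i : ∀ k → f (punchIn i k) ≡ 0
    off-i k rewrite eqFin-≢ (FinP.punchInᵢ≢i i k) = refl

  sum-swap-entry : ∀ {n} (f g : Fin n → ℕ) (i : Fin n) → (∀ j → j ≢ i → f j ≡ g j) →
    f i ℕ.+ sum g ≡ g i ℕ.+ sum f
  sum-swap-entry {suc n} f g i agree = begin
    f i ℕ.+ sum g                        ≡⟨ cong (f i ℕ.+_) (sum-remove {i = i} g) ⟩
    f i ℕ.+ (g i ℕ.+ sum (g ∘ punchIn i)) ≡⟨ ℕP.+-comm (f i) _ ⟩
    (g i ℕ.+ sum (g ∘ punchIn i)) ℕ.+ f i ≡⟨ ℕP.+-assoc (g i) _ (f i) ⟩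
    g i ℕ.+ (sum (g ∘ punchIn i) ℕ.+ f i) ≡⟨ cong (λ s → g i ℕ.+ (s ℕ.+ f i)) (sum-cong-≗ agree′) ⟨
    g i ℕ.+ (sum (f ∘ punchIn i) ℕ.+ f i) ≡⟨ cong (g i ℕ.+_) (ℕP.+-comm _ (f i)) ⟩
    g i ℕ.+ (f i ℕ.+ sum (f ∘ punchIn i)) ≡⟨ cong (g i ℕ.+_) (sum-remove {i = i} f) ⟨
    g i ℕ.+ sum f                        ∎
    where
    open ≡-Reasoning
    agree′ : ∀ k → f (punchIn i k) ≡ g (punchIn i k)
    agree′ k = agree (punchIn i k) (FinP.punchInᵢ≢i i k)

  ind : Bool → ℕ
  ind b = if b then 1 else 0

  count : (n : ℕ) → (Fin n → Bool) → ℕ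
  count n b = sum (ind ∘ b)

  count-cong : ∀ n {b b′ : Fin n → Bool} → (∀ u → b u ≡ b′ u) → count n b ≡ count n b′
  count-cong n h = sum-cong-≗ (cong ind ∘ h)

  count-single : ∀ n (i : Fin n) → count n (λ j → eqFin j i) ≡ 1
  count-single n i = sum-single n i 1

  count-complement : ∀ n (b : Fin n → Bool) → count n b ℕ.+ count n (not ∘ b) ≡ n
  count-complement n b =
    trans (sym (∑-distrib-+ (ind ∘ b) (ind ∘ not ∘ b))) (trans (sum-cong-≗ one-of) (sum-const-1 n))
    where
    one-of : ∀ u → ind (b u) ℕ.+ ind (not (b u)) ≡ 1
    one-of u with b u
    ... | true = refl
    ... | false = refl

  count-split : ∀ n (c b : Fin n → Bool) →
    count n b ≡ count n (λ u → c u ∧ b u) ℕ.+ count n (λ u → not (c u) ∧ b u)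
  count-split n c b = trans (sum-cong-≗ split) (∑-distrib-+ (λ u → ind (c u ∧ b u)) (λ u → ind (not (c u) ∧ b u)))
    where
    split : ∀ u → ind (b u) ≡ ind (c u ∧ b u) ℕ.+ ind (not (c u) ∧ b u)
    split u with c u | b u
    ... | true | true = refl
    ... | true | false = refl
    ... | false | true = refl
    ... | false | false = refl

  sumP-const : ∀ n (b : Fin n → Bool) (f : Fin n → ℕ) →
    sumP n (λ k → if b k then const (+ f k) else []) ≈ const (+ sum (λ k → if b k then f k else 0))
  sumP-const zero b f = ≈-sym (0∷≈[] ≈-refl)
  sumP-const (suc n) b f with b zero
  ... | true = ⊕-cong {p = const (+ f zero)} ≈-refl (sumP-const n (b ∘ suc) (f ∘ suc))
  ... | false = sumP-const n (b ∘ suc) (f ∘ suc)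

  +-neg-one* : ∀ z → z ℤ.+ (- + 1) ℤ.* z ≡ + 0
  +-neg-one* z = trans (cong (λ w → z ℤ.+ w) (ℤP.-1*i≡-i z)) (ℤP.+-inverseʳ z)

  sumP-count : ∀ n (z : ℤ) (b : Fin n → Bool) →
    sumP n (λ k → if b k then const z else []) ≈ const (z ℤ.* + count n b)
  sumP-count zero z b = ≈-sym (const-≈[] (ℤP.*-zeroʳ z))
  sumP-count (suc n) z b with b zero
  ... | true = ≈-trans (⊕-cong {p = const z} ≈-refl (sumP-count n z (b ∘ suc)))
                     (const-cong (sym (ℤP.*-suc z (+ count n (b ∘ suc)))))
  ... | false = sumP-count n z (b ∘ suc)

  sumP-replace-at : ∀ n (c : Fin n) (F G : Fin n → Poly) → G c ≈ [] →
    (∀ k → k ≢ c → G k ≈ F k) → F c ⊕ sumP n G ≈ sumP n F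
  sumP-replace-at (suc n) c F G G-c G≈F =
    ≈-trans (⊕-cong {p = F c} ≈-refl (≈-trans (sumP-extract n c G)
               (⊕-cong G-c (sumP-cong n (λ j → G≈F (punchIn c j) (FinP.punchInᵢ≢i c j))))))
            (≈-sym (sumP-extract n c F))

  sumP-constant-but-one : ∀ n (p : Fin n) (b : Fin n → Bool) (F : Fin n → Poly) (d : Poly) (z : ℤ) →
    b p ≡ true → F p ≈ d → (∀ k → k ≢ p → b k ≡ true → F k ≈ const z) →
    sumP n (λ k → if b k then F k else []) ⊕ const z ≈ d ⊕ const (z ℤ.* + count n b)
  sumP-constant-but-one (suc n) p b F d z b-p F-p F-k =
    ≈-trans (⊕-cong (sumP-extract n p (λ k → if b k then F k else [])) (≈-refl {const z}))
    (≈-trans (⊕-cong (⊕-cong at-p (≈-trans (sumP-cong n others) (sumP-count n z (b ∘ punchIn p))))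
                     (≈-refl {const z}))
    (≈-trans (⊕-assoc d _ (const z))
    (⊕-cong {p = d} ≈-refl (const-cong (begin
      z ℤ.* + rest ℤ.+ z        ≡⟨ ℤP.+-comm (z ℤ.* + rest) z ⟩
      z ℤ.+ z ℤ.* + rest        ≡⟨ ℤP.*-suc z (+ rest) ⟨
      z ℤ.* + suc rest          ≡⟨ cong (λ m → z ℤ.* + m) count-b ⟨
      z ℤ.* + count (suc n) b   ∎)))))
    where
    open ≡-Reasoning
    rest : ℕ
    rest = count n (b ∘ punchIn p)
    at-p : (if b p then F p else []) ≈ d
    at-p rewrite b-p = F-p
    others : ∀ j → (if b (punchIn p j) then F (punchIn p j) else []) ≈ (if b (punchIn p j) then const z else [])
    others j with b (punchIn p j) in e
    ... | true = F-k (punchIn p j) (FinP.punchInᵢ≢i p j) e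
    ... | false = ≈-refl
    count-b : count (suc n) b ≡ suc rest
    count-b = trans (sum-remove {i = p} (ind ∘ b)) (cong (λ x → ind x ℕ.+ rest) b-p)

  prodP-count : ∀ n (b : Fin n → Bool) (p : Poly) →
    prodP n (λ u → if b u then p else one) ≈ p ^^ count n b
  prodP-count zero b p = ≈-refl
  prodP-count (suc n) b p with b zero
  ... | true = ⊗-congʳ p (prodP-count n (b ∘ suc) p)
  ... | false = ≈-trans (⊗-identityˡ _) (prodP-count n (b ∘ suc) p)

  firstWhere : ∀ n → (Fin n → Bool) → Maybe (Fin n)
  firstWhere zero b = nothing
  firstWhere (suc n) b = if b zero then just zero else Maybe.map suc (firstWhere n (b ∘ suc))

  firstWhere-sound : ∀ n (b : Fin n → Bool) w → firstWhere n b ≡ just w → b w ≡ true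
  firstWhere-sound (suc n) b w e with b zero in b₀
  firstWhere-sound (suc n) b .zero refl | true = b₀
  ... | false with firstWhere n (b ∘ suc) in found
  firstWhere-sound (suc n) b .(suc w′) refl | false | just w′ = firstWhere-sound n (b ∘ suc) w′ found

  firstWhere-complete : ∀ n (b : Fin n → Bool) w → b w ≡ true → Σ (Fin n) (λ w′ → firstWhere n b ≡ just w′)
  firstWhere-complete (suc n) b w e with b zero in b₀
  ... | true = zero , refl
  firstWhere-complete (suc n) b zero e | false = ⊥-elim (true≢false e b₀)
  firstWhere-complete (suc n) b (suc w) e | false with firstWhere-complete n (b ∘ suc) w e
  ... | w′ , found rewrite found = suc w′ , refl

  module CompleteMultipartite (N : ℕ) (part : Fin N → ℕ) (a₀ : Fin N) where

    samePart : Fin N → Fin N → Bool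
    samePart u v = ⌊ part u ℕ.≟ part v ⌋

    samePart⇒≡ : ∀ {u v} → samePart u v ≡ true → part u ≡ part v
    samePart⇒≡ = ⌊⌋-true⇒ (_ ℕ.≟ _)

    samePart-false⇒≢ : ∀ {u v} → samePart u v ≡ false → part u ≢ part v
    samePart-false⇒≢ = ⌊⌋-false⇒ (_ ℕ.≟ _)

    ≡⇒samePart : ∀ {u v} → part u ≡ part v → samePart u v ≡ true
    ≡⇒samePart = ⌊⌋-yes (_ ℕ.≟ _)

    ≢⇒samePart-false : ∀ {u v} → part u ≢ part v → samePart u v ≡ false
    ≢⇒samePart-false = ⌊⌋-no (_ ℕ.≟ _)

    samePart-cong : ∀ {u u′} → part u ≡ part u′ → ∀ c → samePart u c ≡ samePart u′ c
    samePart-cong e c rewrite e = refl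

    samePart-refl : ∀ u → samePart u u ≡ true
    samePart-refl u = ≡⇒samePart refl

    firstInPart : ℕ → Maybe (Fin N)
    firstInPart ℓ = firstWhere N (λ w → ⌊ ℓ ℕ.≟ part w ⌋)

    -- The first vertex in u's part; the fallback u is never taken.
    rep : Fin N → Fin N
    rep u = fromMaybe u (firstInPart (part u))

    firstInPart-found : ∀ u → Σ (Fin N) (λ w → firstInPart (part u) ≡ just w)
    firstInPart-found u = firstWhere-complete N _ u (⌊⌋-yes (part u ℕ.≟ part u) refl)

    part-rep : ∀ u → part (rep u) ≡ part u
    part-rep u with firstInPart-found u
    ... | w , found rewrite found = sym (⌊⌋-true⇒ (part u ℕ.≟ part w) (firstWhere-sound N _ w found))

    rep-cong : ∀ u v → part u ≡ part v → rep u ≡ rep v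
    rep-cong u v e with firstInPart-found u
    ... | w , found rewrite found | sym e | found = refl

    isRep : Fin N → Bool
    isRep u = eqFin (rep u) u

    pivot : Fin N
    pivot = rep a₀

    rep-idem : ∀ u → rep (rep u) ≡ rep u
    rep-idem u = rep-cong (rep u) u (part-rep u)

    isRep-rep : ∀ u → isRep (rep u) ≡ true
    isRep-rep u rewrite rep-idem u = eqFin-refl (rep u)

    isRep⇒rep≡ : ∀ {u} → isRep u ≡ true → rep u ≡ u
    isRep⇒rep≡ = eqFin-true⇒≡

    ¬isRep⇒rep≢ : ∀ {u} → isRep u ≡ false → rep u ≢ u
    ¬isRep⇒rep≢ = eqFin-false⇒≢

    isRep-pivot : isRep pivot ≡ true
    isRep-pivot = isRep-rep a₀

    rep-of-part : ∀ {c k} → isRep c ≡ true → part k ≡ part c → rep k ≡ c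
    rep-of-part {c} {k} c-rep e = trans (rep-cong k c e) (isRep⇒rep≡ c-rep)

    reps-same-part⇒≡ : ∀ {c k} → isRep c ≡ true → isRep k ≡ true → part c ≡ part k → c ≡ k
    reps-same-part⇒≡ c-rep k-rep e = trans (sym (rep-of-part c-rep refl)) (rep-of-part k-rep e)

    rep≢member : ∀ {u v} → isRep u ≡ true → isRep v ≡ false → eqFin u v ≡ false
    rep≢member u-rep v-member = eqFin-≢ λ u≡v → true≢false (trans (cong isRep (sym u≡v)) u-rep) v-member

    partSize : Fin N → ℕ
    partSize u = count N (samePart u)

    partSize-cong : ∀ {u u′} → part u ≡ part u′ → partSize u ≡ partSize u′
    partSize-cong e = count-cong N (samePart-cong e)

    distinctDist : Fin N → Fin N → ℕ
    distinctDist u c = if samePart u c then 2 else 1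

    dist : Fin N → Fin N → ℕ
    dist u c = if eqFin u c then 0 else distinctDist u c

    transmission : Fin N → ℕ
    transmission u = sum (dist u)

    transmission+2 : ∀ u → transmission u ℕ.+ 2 ≡ N ℕ.+ partSize u
    transmission+2 u = begin
      transmission u ℕ.+ 2                   ≡⟨ ℕP.+-comm _ 2 ⟩
      2 ℕ.+ sum (dist u)                     ≡⟨ cong (ℕ._+ sum (dist u)) distinctDist-self ⟨
      distinctDist u u ℕ.+ sum (dist u)      ≡⟨ sum-swap-entry (distinctDist u) (dist u) u off-u ⟩
      dist u u ℕ.+ sum (distinctDist u)      ≡⟨ cong (ℕ._+ sum (distinctDist u)) dist-self ⟩
      sum (distinctDist u)                   ≡⟨ sum-cong-≗ one+samePart ⟩
      sum (λ c → 1 ℕ.+ ind (samePart u c))   ≡⟨ ∑-distrib-+ (λ _ → 1) (ind ∘ samePart u) ⟩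
      sum {N} (λ _ → 1) ℕ.+ partSize u       ≡⟨ cong (ℕ._+ partSize u) (sum-const-1 N) ⟩
      N ℕ.+ partSize u                       ∎
      where
      open ≡-Reasoning
      dist-self : dist u u ≡ 0
      dist-self rewrite eqFin-refl u = refl
      distinctDist-self : distinctDist u u ≡ 2
      distinctDist-self rewrite samePart-refl u = refl
      off-u : ∀ c → c ≢ u → distinctDist u c ≡ dist u c
      off-u c c≢u rewrite eqFin-≢ (c≢u ∘ sym) = refl
      one+samePart : ∀ c → distinctDist u c ≡ 1 ℕ.+ ind (samePart u c)
      one+samePart c with samePart u c
      ... | true = refl
      ... | false = refl

    charMatrix : Mat N
    charMatrix u c = if eqFin u c then X ⊕ const (- (+ transmission u)) else const (+ distinctDist u c)

    δ : Fin N → Fin N → Poly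
    δ = identity N

    δ-diff : Fin N → Fin N → Fin N → Poly
    δ-diff u v c = δ u c ⊕ neg (δ v c)

    δ-diff-cancel : ∀ u v c → δ-diff u v c ⊕ δ v c ≈ δ u c
    δ-diff-cancel u v c =
      ≈-trans (⊕-assoc (δ u c) (neg (δ v c)) (δ v c))
              (≈-trans (⊕-cong {p = δ u c} ≈-refl (≈-trans (⊕-comm (neg (δ v c)) (δ v c)) (⊕-inverseʳ (δ v c))))
                       (⊕-identityʳ (δ u c)))

    memberFactor : Fin N → Poly
    memberFactor u = lin (+ (N ℕ.+ partSize u))

    isMember : Fin N → Bool
    isMember u = not (isRep u)

    -- Members are the non-representatives; their rows produce the eigenvalues N + |part u|.
    member-row-difference : ∀ u c → isRep u ≡ false →
      memberFactor u ⊗ δ-diff u (rep u) c ≈ charMatrix u c ⊕ neg (charMatrix (rep u) c)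
    member-row-difference u c u-member with eqFin u c in u≐c | eqFin (rep u) c in ru≐c
    ... | true | true = ⊥-elim (¬isRep⇒rep≢ u-member (trans (eqFin-true⇒≡ ru≐c) (sym (eqFin-true⇒≡ u≐c))))
    ... | true | false rewrite sym (eqFin-true⇒≡ u≐c) | ≡⇒samePart {rep u} {u} (part-rep u) =
      ≈-trans (⊗-identityʳ (memberFactor u))
              (∷-cong (sym (trans (diagonal (transmission u)) (cong (λ z → - (+ z)) (transmission+2 u)))) ≈-refl)
      where
      open +-*-Solver
      diagonal : ∀ t → (+ 0 ℤ.+ - (+ t)) ℤ.+ (- (+ 1) ℤ.* + 2) ≡ - (+ t ℤ.+ + 2)
      diagonal t = solve 1 (λ T → (con (+ 0) :+ :- T) :+ (:- con (+ 1) :* con (+ 2)) := :- (T :+ con (+ 2))) refl (+ t)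
    ... | false | true rewrite sym (eqFin-true⇒≡ ru≐c) | ≡⇒samePart {u} {rep u} (sym (part-rep u)) =
      ≈-trans (⊗-neg-one (memberFactor u))
        (∷-cong (sym (trans (repColumn (transmission (rep u)))
          (cong (λ z → - (+ 1) ℤ.* - (+ z))
                (trans (transmission+2 (rep u)) (cong (N ℕ.+_) (partSize-cong (part-rep u))))))) ≈-refl)
      where
      open +-*-Solver
      repColumn : ∀ t → + 2 ℤ.+ (- (+ 1) ℤ.* (+ 0 ℤ.+ - (+ t))) ≡ - (+ 1) ℤ.* (- (+ t ℤ.+ + 2))
      repColumn t = solve 1 (λ T → con (+ 2) :+ (:- con (+ 1) :* (con (+ 0) :+ :- T))
                                   := :- con (+ 1) :* (:- (T :+ con (+ 2)))) refl (+ t)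
    ... | false | false rewrite samePart-cong {rep u} {u} (part-rep u) c =
      ≈-trans (⊗-zeroʳ (memberFactor u)) (≈-sym (const-≈[] (+-neg-one* (+ distinctDist u c))))

    Q₁ : Mat N
    Q₁ u c = if isRep u then charMatrix u c else memberFactor u ⊗ δ-diff u (rep u) c

    subtract-rep-rows : det N Q₁ ≈ det N charMatrix
    subtract-rep-rows = det-row-combinations N isMember coeffs charMatrix Q₁ coeffs-rep rep-rows member-rows
      where
      coeffs : Fin N → Fin N → Poly
      coeffs u k = if eqFin k (rep u) then neg one else []
      coeffs-rep : ∀ i k → isMember k ≡ true → coeffs i k ≈ []
      coeffs-rep i k k-member with eqFin k (rep i) in k≐ri
      ... | true = ⊥-elim (true≢false (trans (cong isRep (eqFin-true⇒≡ k≐ri)) (isRep-rep i))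
                                      (not≡true⇒≡false k-member))
      ... | false = ≈-refl
      rep-rows : ∀ r c → isMember r ≡ false → Q₁ r c ≈ charMatrix r c
      rep-rows r c e rewrite not≡false⇒≡true e = ≈-refl
      combination : ∀ u c → sumP N (λ k → coeffs u k ⊗ charMatrix k c) ≈ neg (charMatrix (rep u) c)
      combination u c = sumP-single N (rep u) _ _ λ k → lemma k
        where
        lemma : ∀ k → coeffs u k ⊗ charMatrix k c ≈ (if eqFin k (rep u) then neg (charMatrix (rep u) c) else [])
        lemma k with eqFin k (rep u) in k≐ru
        ... | true rewrite eqFin-true⇒≡ k≐ru = neg-one-⊗ (charMatrix (rep u) c)
        ... | false = ≈-refl
      member-rows : ∀ r c → isMember r ≡ true → Q₁ r c ≈ charMatrix r c ⊕ sumP N (λ k → coeffs r k ⊗ charMatrix k c)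
      member-rows r c e rewrite not≡true⇒≡false e =
        ≈-trans (member-row-difference r c (not≡true⇒≡false e))
                (⊕-cong {p = charMatrix r c} ≈-refl (≈-sym (combination r c)))

    Q₂ : Mat N
    Q₂ u c = if isRep u then charMatrix u c else δ-diff u (rep u) c

    memberFactors : Poly
    memberFactors = prodP N (λ r → if isMember r then memberFactor r else one)

    factor-member-rows : det N Q₁ ≈ memberFactors ⊗ det N Q₂
    factor-member-rows = det-scale-rows N isMember memberFactor Q₁ Q₂ member-rows rep-rows
      where
      member-rows : ∀ r c → isMember r ≡ true → Q₁ r c ≈ memberFactor r ⊗ Q₂ r c
      member-rows r c e rewrite not≡true⇒≡false e = ≈-refl
      rep-rows : ∀ r c → isMember r ≡ false → Q₁ r c ≈ Q₂ r c
      rep-rows r c e rewrite not≡false⇒≡true e = ≈-refl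

    partSum : Fin N → Fin N → Poly
    partSum p c = sumP N (λ k → if samePart c k then charMatrix p k else [])

    partSum-diagonal : ∀ p → partSum p p ≈ X ⊕ const (+ partSize p ℤ.- + N)
    partSum-diagonal p =
      ≈-trans (≈-sym (≈-trans (⊕-assoc (partSum p p) (const (+ 2)) (const (- + 2)))
                (≈-trans (⊕-cong {p = partSum p p} ≈-refl (const-≈[] (ℤP.+-inverseʳ (+ 2))))
                         (⊕-identityʳ (partSum p p)))))
      (≈-trans (⊕-cong (sumP-constant-but-one N p (samePart p) (charMatrix p) (X ⊕ const (- + transmission p))
                          (+ 2) (samePart-refl p) at-p in-part)
                       (≈-refl {const (- + 2)}))
               (∷-cong (coefficient {transmission p} {partSize p} {N} (transmission+2 p)) ≈-refl))
      where
      at-p : charMatrix p p ≈ X ⊕ const (- + transmission p)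
      at-p rewrite eqFin-refl p = ≈-refl
      in-part : ∀ k → k ≢ p → samePart p k ≡ true → charMatrix p k ≈ const (+ 2)
      in-part k k≢p e rewrite eqFin-≢ (k≢p ∘ sym) | e = ≈-refl
      open +-*-Solver
      coefficient : ∀ {t s n} → t ℕ.+ 2 ≡ n ℕ.+ s →
        ((+ 0 ℤ.+ - + t) ℤ.+ + 2 ℤ.* + s) ℤ.+ - + 2 ≡ + 0 ℤ.+ (+ s ℤ.- + n)
      coefficient {t} {s} {n} e = begin
        ((+ 0 ℤ.+ - + t) ℤ.+ + 2 ℤ.* + s) ℤ.+ - + 2
          ≡⟨ solve 3 (λ T S V → ((con (+ 0) :+ :- T) :+ con (+ 2) :* S) :+ :- con (+ 2)
                                 := (con (+ 0) :+ (S :- V)) :+ ((V :+ S) :- (T :+ con (+ 2)))) refl (+ t) (+ s) (+ n) ⟩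
        (+ 0 ℤ.+ (+ s ℤ.- + n)) ℤ.+ (+ (n ℕ.+ s) ℤ.- + (t ℕ.+ 2))
          ≡⟨ cong (λ m → (+ 0 ℤ.+ (+ s ℤ.- + n)) ℤ.+ (+ m ℤ.- + (t ℕ.+ 2))) e ⟨
        (+ 0 ℤ.+ (+ s ℤ.- + n)) ℤ.+ (+ (t ℕ.+ 2) ℤ.- + (t ℕ.+ 2))
          ≡⟨ cong (λ w → (+ 0 ℤ.+ (+ s ℤ.- + n)) ℤ.+ w) (ℤP.+-inverseʳ (+ (t ℕ.+ 2))) ⟩
        (+ 0 ℤ.+ (+ s ℤ.- + n)) ℤ.+ + 0
          ≡⟨ ℤP.+-identityʳ _ ⟩
        + 0 ℤ.+ (+ s ℤ.- + n) ∎
        where open ≡-Reasoning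

    partSum-off-diagonal : ∀ p c → isRep p ≡ true → isRep c ≡ true → eqFin c p ≡ false →
      partSum p c ≈ const (+ partSize c)
    partSum-off-diagonal p c p-rep c-rep c≢p =
      ≈-trans (sumP-cong N entry) (≈-trans (sumP-count N (+ 1) (samePart c)) (const-cong (ℤP.*-identityˡ _)))
      where
      entry : ∀ k → (if samePart c k then charMatrix p k else []) ≈ (if samePart c k then const (+ 1) else [])
      entry k with samePart c k in c~k
      ... | false = ≈-refl
      ... | true
        rewrite eqFin-≢ {i = p} {k} (λ p≡k → eqFin-false⇒≢ c≢p
                  (reps-same-part⇒≡ c-rep p-rep (trans (samePart⇒≡ c~k) (cong part (sym p≡k)))))
              | ≢⇒samePart-false {p} {k} (λ e → eqFin-false⇒≢ c≢p
                  (reps-same-part⇒≡ c-rep p-rep (trans (samePart⇒≡ c~k) (sym e)))) = ≈-refl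

    collapsedRow : Fin N → Fin N → Poly
    collapsedRow p c =
      if isRep c then (if eqFin c p then X ⊕ const (+ partSize p ℤ.- + N) else const (+ partSize c)) else []

    Q₃ : Mat N
    Q₃ u c = if isRep u then collapsedRow u c else δ-diff u (rep u) c

    -- Adding −(charMatrix p k) · row k for every member k moves each entry of row p into the
    -- column of the representative of its part.
    collapse-row : ∀ p c → isRep p ≡ true →
      collapsedRow p c ≈ charMatrix p c ⊕ sumP N (λ k → (if isRep k then [] else neg (charMatrix p k)) ⊗ Q₂ k c)
    collapse-row p c p-rep with isRep c in c-rep
    ... | false = ≈-sym (≈-trans (⊕-cong {p = charMatrix p c} ≈-refl (sumP-single N c _ _ term))
                                 (⊕-inverseʳ (charMatrix p c)))
      where
      term : ∀ k → (if isRep k then [] else neg (charMatrix p k)) ⊗ Q₂ k c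
                   ≈ (if eqFin k c then neg (charMatrix p c) else [])
      term k with isRep k in k-rep | eqFin k c in k≐c
      ... | true | true = ⊥-elim (true≢false (trans (cong isRep (sym (eqFin-true⇒≡ k≐c))) k-rep) c-rep)
      ... | true | false = ≈-refl
      ... | false | true rewrite eqFin-true⇒≡ k≐c | rep≢member (isRep-rep c) c-rep =
        ⊗-identityʳ (neg (charMatrix p c))
      ... | false | false rewrite rep≢member (isRep-rep k) c-rep = ⊗-zeroʳ (neg (charMatrix p k))
    ... | true = ≈-sym (≈-trans (⊕-cong (≈-sym at-c) (≈-refl {sumP N G}))
                      (≈-trans (sumP-replace-at N c (λ k → if samePart c k then charMatrix p k else []) G G-c G≈F)
                               (by-diagonal (eqFin c p) refl)))
      where
      G : Fin N → Poly
      G k = (if isRep k then [] else neg (charMatrix p k)) ⊗ Q₂ k c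
      at-c : (if samePart c c then charMatrix p c else []) ≈ charMatrix p c
      at-c rewrite samePart-refl c = ≈-refl
      G-c : G c ≈ []
      G-c rewrite c-rep = ≈-refl
      G≈F : ∀ k → k ≢ c → G k ≈ (if samePart c k then charMatrix p k else [])
      G≈F k k≢c with isRep k in k-rep | samePart c k in c~k
      ... | true | true = ⊥-elim (k≢c (sym (reps-same-part⇒≡ c-rep k-rep (samePart⇒≡ c~k))))
      ... | true | false = ≈-refl
      ... | false | true rewrite eqFin-≢ k≢c | rep-of-part {c} {k} c-rep (sym (samePart⇒≡ c~k)) | eqFin-refl c =
        ≈-trans (⊗-neg-one (neg (charMatrix p k))) (neg-involutive (charMatrix p k))
      ... | false | false
        rewrite eqFin-≢ k≢c
              | eqFin-≢ {i = rep k} {c} (λ e → samePart-false⇒≢ c~k (sym (trans (sym (part-rep k)) (cong part e)))) =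
        ⊗-zeroʳ (neg (charMatrix p k))
      by-diagonal : ∀ b → eqFin c p ≡ b →
        partSum p c ≈ (if b then X ⊕ const (+ partSize p ℤ.- + N) else const (+ partSize c))
      by-diagonal true c≐p rewrite eqFin-true⇒≡ c≐p = partSum-diagonal p
      by-diagonal false c≢p = partSum-off-diagonal p c p-rep c-rep c≢p

    clear-member-columns : det N Q₃ ≈ det N Q₂
    clear-member-columns = det-row-combinations N isRep coeffs Q₂ Q₃ coeffs-rep member-rows rep-rows
      where
      coeffs : Fin N → Fin N → Poly
      coeffs p k = if isRep k then [] else neg (charMatrix p k)
      coeffs-rep : ∀ i k → isRep k ≡ true → coeffs i k ≈ []
      coeffs-rep i k e rewrite e = ≈-refl
      member-rows : ∀ r c → isRep r ≡ false → Q₃ r c ≈ Q₂ r c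
      member-rows r c e rewrite e = ≈-refl
      rep-rows : ∀ r c → isRep r ≡ true → Q₃ r c ≈ Q₂ r c ⊕ sumP N (λ k → coeffs r k ⊗ Q₂ k c)
      rep-rows r c e rewrite e = collapse-row r c e

    isOtherRep : Fin N → Bool
    isOtherRep u = isRep u ∧ not (eqFin u pivot)

    isOtherRep⇒ : ∀ {r} → isOtherRep r ≡ true → isRep r ≡ true × eqFin r pivot ≡ false
    isOtherRep⇒ {r} e with isRep r | eqFin r pivot
    ... | true | false = refl , refl

    Q₄ : Mat N
    Q₄ u c = if isRep u
      then (if eqFin u pivot then collapsedRow pivot c else lin (+ N) ⊗ δ-diff u pivot c)
      else δ-diff u (rep u) c

    -- These rows produce the eigenvalue N, once for each part but the pivot's.
    rep-row-difference : ∀ p c → isRep p ≡ true → eqFin p pivot ≡ false →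
      lin (+ N) ⊗ δ-diff p pivot c ≈ collapsedRow p c ⊕ neg (collapsedRow pivot c)
    rep-row-difference p c p-rep p≢pivot with isRep c in c-rep
    ... | false rewrite rep≢member p-rep c-rep | rep≢member isRep-pivot c-rep = ⊗-zeroʳ (lin (+ N))
    ... | true rewrite eqFin-sym p c | eqFin-sym pivot c with eqFin c p in c≐p | eqFin c pivot in c≐pivot
    ...   | true | true = ⊥-elim (true≢false (trans (sym (cong (λ z → eqFin z pivot) (eqFin-true⇒≡ c≐p))) c≐pivot) p≢pivot)
    ...   | true | false rewrite eqFin-true⇒≡ c≐p =
      ≈-trans (⊗-identityʳ (lin (+ N))) (∷-cong (sym (own-column (partSize p) N)) ≈-refl)
      where
      open +-*-Solver
      own-column : ∀ s n → (+ 0 ℤ.+ (+ s ℤ.- + n)) ℤ.+ (- + 1 ℤ.* + s) ≡ - + n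
      own-column s n = solve 2 (λ S V → (con (+ 0) :+ (S :- V)) :+ (:- con (+ 1) :* S) := :- V) refl (+ s) (+ n)
    ...   | false | true rewrite eqFin-true⇒≡ c≐pivot =
      ≈-trans (⊗-neg-one (lin (+ N))) (∷-cong (sym (pivot-column (partSize pivot) N)) ≈-refl)
      where
      open +-*-Solver
      pivot-column : ∀ s n → + s ℤ.+ (- + 1 ℤ.* (+ 0 ℤ.+ (+ s ℤ.- + n))) ≡ - + 1 ℤ.* (- + n)
      pivot-column s n = solve 2 (λ S V → S :+ (:- con (+ 1) :* (con (+ 0) :+ (S :- V))) := :- con (+ 1) :* (:- V))
                               refl (+ s) (+ n)
    ...   | false | false = ≈-trans (⊗-zeroʳ (lin (+ N))) (≈-sym (const-≈[] (+-neg-one* (+ partSize c))))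

    subtract-pivot-row : det N Q₄ ≈ det N Q₃
    subtract-pivot-row = det-row-combinations N isOtherRep coeffs Q₃ Q₄ coeffs-other unchanged other-rows
      where
      coeffs : Fin N → Fin N → Poly
      coeffs p k = if eqFin k pivot then neg one else []
      coeffs-other : ∀ i k → isOtherRep k ≡ true → coeffs i k ≈ []
      coeffs-other i k e rewrite proj₂ (isOtherRep⇒ e) = ≈-refl
      unchanged : ∀ r c → isOtherRep r ≡ false → Q₄ r c ≈ Q₃ r c
      unchanged r c e with isRep r in r-rep | eqFin r pivot in r≐pivot
      ... | false | _ = ≈-refl
      ... | true | true rewrite eqFin-true⇒≡ r≐pivot = ≈-refl
      unchanged r c () | true | false
      combination : ∀ r c → sumP N (λ k → coeffs r k ⊗ Q₃ k c) ≈ neg (collapsedRow pivot c)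
      combination r c = sumP-single N pivot _ _ term
        where
        term : ∀ k → coeffs r k ⊗ Q₃ k c ≈ (if eqFin k pivot then neg (collapsedRow pivot c) else [])
        term k with eqFin k pivot in k≐pivot
        ... | true rewrite eqFin-true⇒≡ k≐pivot | isRep-pivot = neg-one-⊗ (collapsedRow pivot c)
        ... | false = ≈-refl
      other-rows : ∀ r c → isOtherRep r ≡ true → Q₄ r c ≈ Q₃ r c ⊕ sumP N (λ k → coeffs r k ⊗ Q₃ k c)
      other-rows r c e with isOtherRep⇒ e
      ... | r-rep , r≢pivot rewrite r-rep | r≢pivot =
        ≈-trans (rep-row-difference r c r-rep r≢pivot)
                (⊕-cong {p = collapsedRow r c} ≈-refl (≈-sym (combination r c)))

    Q₅ : Mat N
    Q₅ u c = if isRep u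
      then (if eqFin u pivot then collapsedRow pivot c else δ-diff u pivot c)
      else δ-diff u (rep u) c

    repFactors : Poly
    repFactors = prodP N (λ r → if isOtherRep r then lin (+ N) else one)

    factor-rep-rows : det N Q₄ ≈ repFactors ⊗ det N Q₅
    factor-rep-rows = det-scale-rows N isOtherRep (λ _ → lin (+ N)) Q₄ Q₅ other-rows unchanged
      where
      other-rows : ∀ r c → isOtherRep r ≡ true → Q₄ r c ≈ lin (+ N) ⊗ Q₅ r c
      other-rows r c e rewrite proj₁ (isOtherRep⇒ e) | proj₂ (isOtherRep⇒ e) = ≈-refl
      unchanged : ∀ r c → isOtherRep r ≡ false → Q₄ r c ≈ Q₅ r c
      unchanged r c e with isRep r | eqFin r pivot
      ... | false | _ = ≈-refl
      ... | true | true = ≈-refl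
      unchanged r c () | true | false

    sum-partSize-reps : sum (λ k → if isRep k then partSize k else 0) ≡ N
    sum-partSize-reps = begin
      sum (λ k → if isRep k then partSize k else 0)
        ≡⟨ sum-cong-≗ as-count ⟩
      sum (λ k → sum (λ w → ind (isRep k ∧ samePart k w)))
        ≡⟨ ∑-comm (λ k w → ind (isRep k ∧ samePart k w)) ⟩
      sum (λ w → sum (λ k → ind (isRep k ∧ samePart k w)))
        ≡⟨ sum-cong-≗ (λ w → trans (count-cong N (is-rep-of w)) (count-single N (rep w))) ⟩
      sum {N} (λ _ → 1)
        ≡⟨ sum-const-1 N ⟩
      N ∎
      where
      open ≡-Reasoning
      as-count : ∀ k → (if isRep k then partSize k else 0) ≡ sum (λ w → ind (isRep k ∧ samePart k w))
      as-count k with isRep k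
      ... | true = refl
      ... | false = sym (sum-≡0 N _ (λ _ → refl))
      is-rep-of : ∀ w k → (isRep k ∧ samePart k w) ≡ eqFin k (rep w)
      is-rep-of w k with k Fin.≟ rep w
      ... | yes refl rewrite isRep-rep w = ≡⇒samePart (part-rep w)
      ... | no k≢rw with isRep k in k-rep | samePart k w in k~w
      ...   | true | true = ⊥-elim (k≢rw (sym (rep-of-part k-rep (sym (samePart⇒≡ k~w)))))
      ...   | true | false = refl
      ...   | false | _ = refl

    sum-partSize-other-reps : sum (λ k → if isOtherRep k then partSize k else 0) ℕ.+ partSize pivot ≡ N
    sum-partSize-other-reps = begin
      sum (λ k → if isOtherRep k then partSize k else 0) ℕ.+ partSize pivot
        ≡⟨ cong (sum (λ k → if isOtherRep k then partSize k else 0) ℕ.+_) (sum-single N pivot (partSize pivot)) ⟨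
      sum (λ k → if isOtherRep k then partSize k else 0) ℕ.+ sum (λ k → if eqFin k pivot then partSize pivot else 0)
        ≡⟨ ∑-distrib-+ (λ k → if isOtherRep k then partSize k else 0) _ ⟨
      sum (λ k → (if isOtherRep k then partSize k else 0) ℕ.+ (if eqFin k pivot then partSize pivot else 0))
        ≡⟨ sum-cong-≗ split ⟩
      sum (λ k → if isRep k then partSize k else 0)
        ≡⟨ sum-partSize-reps ⟩
      N ∎
      where
      open ≡-Reasoning
      split : ∀ k → (if isOtherRep k then partSize k else 0) ℕ.+ (if eqFin k pivot then partSize pivot else 0)
                    ≡ (if isRep k then partSize k else 0)
      split k with isRep k in k-rep | eqFin k pivot in k≐pivot
      ... | true | true rewrite eqFin-true⇒≡ k≐pivot = refl
      ... | true | false = ℕP.+-identityʳ (partSize k)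
      ... | false | false = refl
      ... | false | true = ⊥-elim (true≢false (trans (cong isRep (eqFin-true⇒≡ k≐pivot)) isRep-pivot) k-rep)

    Q₆ : Mat N
    Q₆ u c = if eqFin u pivot then X ⊗ δ pivot c else Q₅ u c

    pivotCoeffs : Fin N → Poly
    pivotCoeffs k = if isOtherRep k then const (- + partSize k) else []

    pivotCombination : Fin N → Poly
    pivotCombination c = sumP N (λ k → pivotCoeffs k ⊗ Q₅ k c)

    -- Adding |part k| times row k (k another representative) to the pivot row leaves x δ pivot,
    -- since the part sizes add up to N.
    pivot-column : X ⊗ δ pivot pivot ≈ collapsedRow pivot pivot ⊕ pivotCombination pivot
    pivot-column =
      ≈-trans at-pivot (≈-sym (≈-trans (⊕-cong collapsed (≈-trans (sumP-cong N term) (sumP-const N isOtherRep partSize)))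
                                       (∷-cong (coefficient sum-partSize-other-reps) ≈-refl)))
      where
      at-pivot : X ⊗ δ pivot pivot ≈ X
      at-pivot rewrite eqFin-refl pivot = ⊗-identityʳ X
      collapsed : collapsedRow pivot pivot ≈ X ⊕ const (+ partSize pivot ℤ.- + N)
      collapsed rewrite isRep-pivot | eqFin-refl pivot = ≈-refl
      term : ∀ k → pivotCoeffs k ⊗ Q₅ k pivot ≈ (if isOtherRep k then const (+ partSize k) else [])
      term k with isOtherRep k in e
      ... | false = ≈-refl
      ... | true rewrite proj₁ (isOtherRep⇒ e) | proj₂ (isOtherRep⇒ e) | eqFin-refl pivot =
        ≈-trans (const-⊗ (- + partSize k) (neg one)) (const-cong (neg*neg-one (+ partSize k)))
        where
        open +-*-Solver
        neg*neg-one : ∀ z → (- z) ℤ.* (- + 1 ℤ.* + 1) ≡ z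
        neg*neg-one = solve 1 (λ z → (:- z) :* (:- con (+ 1) :* con (+ 1)) := z) refl
      coefficient : ∀ {r s n} → r ℕ.+ s ≡ n → (+ 0 ℤ.+ (+ s ℤ.- + n)) ℤ.+ + r ≡ + 0
      coefficient {r} {s} refl = solve 2 (λ S R → (con (+ 0) :+ (S :- (R :+ S))) :+ R := con (+ 0)) refl (+ s) (+ r)
        where open +-*-Solver

    other-rep-column : ∀ c → isRep c ≡ true → eqFin c pivot ≡ false →
      X ⊗ δ pivot c ≈ collapsedRow pivot c ⊕ pivotCombination c
    other-rep-column c c-rep c≢pivot =
      ≈-trans off-pivot (≈-sym (≈-trans (⊕-cong collapsed (sumP-single N c _ _ term))
                                        (const-≈[] (ℤP.+-inverseʳ (+ partSize c)))))
      where
      pivot≢c : eqFin pivot c ≡ false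
      pivot≢c = trans (eqFin-sym pivot c) c≢pivot
      off-pivot : X ⊗ δ pivot c ≈ []
      off-pivot rewrite pivot≢c = ⊗-zeroʳ X
      collapsed : collapsedRow pivot c ≈ const (+ partSize c)
      collapsed rewrite c-rep | c≢pivot = ≈-refl
      term : ∀ k → pivotCoeffs k ⊗ Q₅ k c ≈ (if eqFin k c then const (- + partSize c) else [])
      term k with isOtherRep k in e | eqFin k c in k≐c
      ... | false | false = ≈-refl
      ... | false | true = ⊥-elim (true≢false c-other e)
        where
        c-other : isOtherRep k ≡ true
        c-other rewrite eqFin-true⇒≡ k≐c | c-rep | c≢pivot = refl
      ... | true | true rewrite proj₁ (isOtherRep⇒ e) | proj₂ (isOtherRep⇒ e) | pivot≢c | eqFin-true⇒≡ k≐c =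
        ⊗-identityʳ (const (- + partSize c))
      ... | true | false rewrite proj₁ (isOtherRep⇒ e) | proj₂ (isOtherRep⇒ e) | pivot≢c =
        ⊗-zeroʳ (const (- + partSize k))

    member-column : ∀ c → isRep c ≡ false → X ⊗ δ pivot c ≈ collapsedRow pivot c ⊕ pivotCombination c
    member-column c c-member = ≈-trans off-pivot (≈-sym (⊕-cong collapsed (sumP-≈[] N term)))
      where
      off-pivot : X ⊗ δ pivot c ≈ []
      off-pivot rewrite rep≢member isRep-pivot c-member = ⊗-zeroʳ X
      collapsed : collapsedRow pivot c ≈ []
      collapsed rewrite c-member = ≈-refl
      term : ∀ k → pivotCoeffs k ⊗ Q₅ k c ≈ []
      term k with isOtherRep k in e
      ... | false = ≈-refl
      ... | true rewrite proj₁ (isOtherRep⇒ e) | proj₂ (isOtherRep⇒ e)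
                       | rep≢member (proj₁ (isOtherRep⇒ e)) c-member | rep≢member isRep-pivot c-member =
        ⊗-zeroʳ (const (- + partSize k))

    pivot-row : ∀ c → X ⊗ δ pivot c ≈ collapsedRow pivot c ⊕ pivotCombination c
    pivot-row c = by-kind (isRep c) refl (eqFin c pivot) refl
      where
      by-kind : ∀ b → isRep c ≡ b → ∀ b′ → eqFin c pivot ≡ b′ →
        X ⊗ δ pivot c ≈ collapsedRow pivot c ⊕ pivotCombination c
      by-kind false c-member _ _ = member-column c c-member
      by-kind true c-rep false c≢pivot = other-rep-column c c-rep c≢pivot
      by-kind true _ true c≐pivot rewrite eqFin-true⇒≡ c≐pivot = pivot-column

    add-rep-rows-to-pivot : det N Q₆ ≈ det N Q₅
    add-rep-rows-to-pivot = det-row-combinations N (λ u → eqFin u pivot) (λ _ → pivotCoeffs) Q₅ Q₆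
                                                  coeffs-pivot unchanged at-pivot
      where
      coeffs-pivot : ∀ i k → eqFin k pivot ≡ true → pivotCoeffs k ≈ []
      coeffs-pivot i k e rewrite eqFin-true⇒≡ e | isRep-pivot | eqFin-refl pivot = ≈-refl
      unchanged : ∀ r c → eqFin r pivot ≡ false → Q₆ r c ≈ Q₅ r c
      unchanged r c e rewrite e = ≈-refl
      at-pivot : ∀ r c → eqFin r pivot ≡ true → Q₆ r c ≈ Q₅ r c ⊕ pivotCombination c
      at-pivot r c e rewrite e | eqFin-true⇒≡ e | isRep-pivot = pivot-row c

    Q₇ : Mat N
    Q₇ u c = if eqFin u pivot then δ pivot c else Q₅ u c

    pivotFactor : Poly
    pivotFactor = prodP N (λ r → if eqFin r pivot then X else one)

    factor-pivot-row : det N Q₆ ≈ pivotFactor ⊗ det N Q₇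
    factor-pivot-row = det-scale-rows N (λ u → eqFin u pivot) (λ _ → X) Q₆ Q₇ at-pivot elsewhere
      where
      at-pivot : ∀ r c → eqFin r pivot ≡ true → Q₆ r c ≈ X ⊗ Q₇ r c
      at-pivot r c e rewrite e = ≈-refl
      elsewhere : ∀ r c → eqFin r pivot ≡ false → Q₆ r c ≈ Q₇ r c
      elsewhere r c e rewrite e = ≈-refl

    Q₈ : Mat N
    Q₈ u c = if isRep u then δ u c else δ-diff u (rep u) c

    restore-rep-rows : det N Q₈ ≈ det N Q₇
    restore-rep-rows = det-row-combinations N isOtherRep (λ _ k → δ k pivot) Q₇ Q₈ coeffs-other unchanged other-rows
      where
      coeffs-other : ∀ i k → isOtherRep k ≡ true → δ k pivot ≈ []
      coeffs-other i k e rewrite proj₂ (isOtherRep⇒ e) = ≈-refl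
      unchanged : ∀ r c → isOtherRep r ≡ false → Q₈ r c ≈ Q₇ r c
      unchanged r c e with isRep r in r-rep | eqFin r pivot in r≐pivot
      ... | false | false = ≈-refl
      ... | false | true = ⊥-elim (true≢false (trans (cong isRep (eqFin-true⇒≡ r≐pivot)) isRep-pivot) r-rep)
      ... | true | true rewrite eqFin-true⇒≡ r≐pivot = ≈-refl
      unchanged r c () | true | false
      other-rows : ∀ r c → isOtherRep r ≡ true → Q₈ r c ≈ Q₇ r c ⊕ sumP N (λ k → δ k pivot ⊗ Q₇ k c)
      other-rows r c e rewrite proj₁ (isOtherRep⇒ e) | proj₂ (isOtherRep⇒ e) =
        ≈-sym (≈-trans (⊕-cong {p = δ-diff r pivot c} ≈-refl (sumP-single N pivot _ _ term))
                       (δ-diff-cancel r pivot c))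
        where
        term : ∀ k → δ k pivot ⊗ Q₇ k c ≈ (if eqFin k pivot then δ pivot c else [])
        term k with eqFin k pivot in k≐pivot
        ... | true = ⊗-identityˡ (δ pivot c)
        ... | false = ≈-refl

    restore-member-rows : det N (identity N) ≈ det N Q₈
    restore-member-rows = det-row-combinations N isMember (λ u k → δ k (rep u)) Q₈ (identity N)
                                                coeffs-member unchanged member-rows
      where
      coeffs-member : ∀ i k → isMember k ≡ true → δ k (rep i) ≈ []
      coeffs-member i k e with eqFin k (rep i) in k≐ri
      ... | true = ⊥-elim (true≢false (trans (cong isRep (eqFin-true⇒≡ k≐ri)) (isRep-rep i)) (not≡true⇒≡false e))
      ... | false = ≈-refl
      unchanged : ∀ r c → isMember r ≡ false → identity N r c ≈ Q₈ r c
      unchanged r c e rewrite not≡false⇒≡true e = ≈-refl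
      member-rows : ∀ r c → isMember r ≡ true → identity N r c ≈ Q₈ r c ⊕ sumP N (λ k → δ k (rep r) ⊗ Q₈ k c)
      member-rows r c e rewrite not≡true⇒≡false e =
        ≈-sym (≈-trans (⊕-cong {p = δ-diff r (rep r) c} ≈-refl (sumP-single N (rep r) _ _ term))
                       (δ-diff-cancel r (rep r) c))
        where
        term : ∀ k → δ k (rep r) ⊗ Q₈ k c ≈ (if eqFin k (rep r) then δ (rep r) c else [])
        term k with eqFin k (rep r) in k≐rr
        ... | true rewrite eqFin-true⇒≡ k≐rr | isRep-rep r = ⊗-identityˡ (δ (rep r) c)
        ... | false = ≈-refl

    det-Q₇ : det N Q₇ ≈ one
    det-Q₇ = ≈-trans (≈-sym restore-rep-rows) (≈-trans (≈-sym restore-member-rows) (det-identity N))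

    eigenFactor : Fin N → Poly
    eigenFactor u = if isRep u then (if eqFin u pivot then X else lin (+ N)) else memberFactor u

    det-charMatrix-factors : det N charMatrix ≈ memberFactors ⊗ (repFactors ⊗ (pivotFactor ⊗ one))
    det-charMatrix-factors = begin
      det N charMatrix                               ≈⟨ subtract-rep-rows ⟨
      det N Q₁                                       ≈⟨ factor-member-rows ⟩
      memberFactors ⊗ det N Q₂                       ≈⟨ ⊗-congʳ memberFactors (begin
        det N Q₂                                       ≈⟨ clear-member-columns ⟨
        det N Q₃                                       ≈⟨ subtract-pivot-row ⟨
        det N Q₄                                       ≈⟨ factor-rep-rows ⟩
        repFactors ⊗ det N Q₅                          ≈⟨ ⊗-congʳ repFactors (begin
          det N Q₅                                       ≈⟨ add-rep-rows-to-pivot ⟨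
          det N Q₆                                       ≈⟨ factor-pivot-row ⟩
          pivotFactor ⊗ det N Q₇                         ≈⟨ ⊗-congʳ pivotFactor det-Q₇ ⟩
          pivotFactor ⊗ one                              ∎) ⟩
        repFactors ⊗ (pivotFactor ⊗ one)               ∎) ⟩
      memberFactors ⊗ (repFactors ⊗ (pivotFactor ⊗ one)) ∎
      where open import Relation.Binary.Reasoning.Setoid ≈-setoid

    det-charMatrix : det N charMatrix ≈ prodP N eigenFactor
    det-charMatrix =
      ≈-trans det-charMatrix-factors
      (≈-trans (⊗-congʳ memberFactors (≈-trans (⊗-congʳ repFactors (⊗-identityʳ pivotFactor)) (prodP-⊗ N _ _)))
      (≈-trans (prodP-⊗ N _ _) (prodP-cong N factor)))
      where
      factor : ∀ u → (if isMember u then memberFactor u else one)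
                       ⊗ ((if isOtherRep u then lin (+ N) else one) ⊗ (if eqFin u pivot then X else one))
                     ≈ eigenFactor u
      factor u with isRep u in u-rep | eqFin u pivot in u≐pivot
      ... | true | true = ≈-trans (⊗-identityˡ _) (⊗-identityˡ X)
      ... | true | false = ≈-trans (⊗-identityˡ _) (⊗-identityʳ (lin (+ N)))
      ... | false | true = ⊥-elim (true≢false (trans (cong isRep (eqFin-true⇒≡ u≐pivot)) isRep-pivot) u-rep)
      ... | false | false = ≈-trans (⊗-congʳ (memberFactor u) (⊗-identityˡ one)) (⊗-identityʳ (memberFactor u))

    count-reps-of-part : ∀ w ℓ → part w ≡ ℓ → count N (λ u → isRep u ∧ ⌊ ℓ ℕ.≟ part u ⌋) ≡ 1
    count-reps-of-part w ℓ w∈ℓ = trans (count-cong N is-rep-w) (count-single N (rep w))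
      where
      is-rep-w : ∀ u → (isRep u ∧ ⌊ ℓ ℕ.≟ part u ⌋) ≡ eqFin u (rep w)
      is-rep-w u with u Fin.≟ rep w
      ... | yes refl rewrite isRep-rep w = ⌊⌋-yes (ℓ ℕ.≟ part (rep w)) (sym (trans (part-rep w) w∈ℓ))
      ... | no u≢rw with isRep u in u-rep | ℓ ℕ.≟ part u
      ...   | true | yes ℓ≡u = ⊥-elim (u≢rw (sym (rep-of-part u-rep (trans w∈ℓ ℓ≡u))))
      ...   | true | no _ = refl
      ...   | false | _ = refl

    count-pivot : count N (λ u → isRep u ∧ eqFin u pivot) ≡ 1
    count-pivot = trans (count-cong N is-pivot) (count-single N pivot)
      where
      is-pivot : ∀ u → (isRep u ∧ eqFin u pivot) ≡ eqFin u pivot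
      is-pivot u with eqFin u pivot in u≐pivot
      ... | true rewrite eqFin-true⇒≡ u≐pivot | isRep-pivot = refl
      ... | false = BoolP.∧-zeroʳ (isRep u)

module QuaternionGroup (m : ℕ) where

  open Booleans using (⌊⌋-yes; ⌊⌋-no)
  open import Data.Nat as ℕ using (ℕ; zero; suc; _+_; _*_; _∸_; _%_; _<_)
  import Data.Nat.Properties as ℕP
  open import Data.Nat.DivMod
  open import Data.Nat.Solver using (module +-*-Solver)
  open import Data.Fin as Fin using (Fin; toℕ)
  import Data.Fin.Properties as FinP
  open import Data.Bool using (Bool; true; false; not; _∧_)
  import Data.Bool.Properties as BoolP
  open import Data.Product using (_,_; proj₁)
  open import Data.Product.Properties using (≡-dec)
  open import Data.Sum using (_⊎_; inj₁; inj₂)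
  open import Data.List using ([]; _∷_; allFin)
  open import Data.List.Membership.Propositional using (_∈_)
  open import Data.List.Membership.Propositional.Properties using (∈-cartesianProduct⁺; ∈-allFin)
  open import Data.List.Relation.Unary.Any using (here; there)
  open import Relation.Binary.PropositionalEquality
    using (_≡_; refl; sym; trans; cong; cong₂; subst₂)
  open import Relation.Nullary using (Dec; yes; no; ¬_)
  open import Relation.Nullary.Decidable using (⌊_⌋; _⊎-dec_)
  open import Function using (_⇔_; mk⇔; Equivalence)
  open import Function.Properties.Equivalence using (⇔-setoid)
  open import Level using (0ℓ)

  n : ℕ
  n = suc (suc m)

  K : ℕ
  K = 2 * n

  open +-*-Solver

  module _ where
    open import Relation.Binary.Reasoning.Setoid (⇔-setoid 0ℓ)

    ≡⇒%-⇔ : ∀ {x x′ y y′} → x ≡ x′ → y ≡ y′ → (x % K ≡ y % K) ⇔ (x′ % K ≡ y′ % K)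
    ≡⇒%-⇔ refl refl = mk⇔ (λ e → e) (λ e → e)

    %-+ʳ-⇔ : ∀ z x y → ((x + z) % K ≡ (y + z) % K) ⇔ (x % K ≡ y % K)
    %-+ʳ-⇔ z x y = mk⇔ cancel (add z {x} {y})
      where
      add : ∀ w {a b} → a % K ≡ b % K → (a + w) % K ≡ (b + w) % K
      add w {a} {b} e =
        trans (%-distribˡ-+ a w K) (trans (cong (λ r → (r + w % K) % K) e) (sym (%-distribˡ-+ b w K)))
      -- Adding (K − 1) z more turns the extra z into a multiple of K.
      absorb : ∀ a → (a + z) + (K ∸ 1) * z ≡ a + z * K
      absorb a = solve 3 (λ a z k → (a :+ z) :+ k :* z := a :+ z :* (con 1 :+ k)) refl a z (K ∸ 1)
      cancel : (x + z) % K ≡ (y + z) % K → x % K ≡ y % K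
      cancel e = trans (sym ([m+kn]%n≡m%n x z K))
        (trans (cong (_% K) (sym (absorb x)))
        (trans (add ((K ∸ 1) * z) {x + z} {y + z} e) (trans (cong (_% K) (absorb y)) ([m+kn]%n≡m%n y z K))))

    *2-%K : ∀ i → (i * 2) % K ≡ (i % n) * 2
    *2-%K i = trans (%-congʳ {o = i * 2} (ℕP.*-comm 2 n)) (sym (m%n*o≡m*o%[n*o] i n 2))

    *2-%-⇔ : ∀ i j → ((i * 2) % K ≡ (j * 2) % K) ⇔ (i % n ≡ j % n)
    *2-%-⇔ i j = mk⇔
      (λ e → ℕP.*-cancelʳ-≡ (i % n) (j % n) 2 (trans (sym (*2-%K i)) (trans e (*2-%K j))))
      (λ e → trans (*2-%K i) (trans (cong (_* 2) e) (sym (*2-%K j))))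

    -- y-elements x^i y and x^j y commute iff i ≡ j (mod n).
    yy-commute-⇔ : ∀ i j → i < K → j < K →
      ((i + (K ∸ j) + n) % K ≡ (j + (K ∸ i) + n) % K) ⇔ (i % n ≡ j % n)
    yy-commute-⇔ i j i<K j<K = begin
      ((i + (K ∸ j) + n) % K ≡ (j + (K ∸ i) + n) % K)                 ≈⟨ %-+ʳ-⇔ (i + j) (i + (K ∸ j) + n) (j + (K ∸ i) + n) ⟨
      (((i + (K ∸ j) + n) + (i + j)) % K ≡ ((j + (K ∸ i) + n) + (i + j)) % K)
                                                                        ≈⟨ ≡⇒%-⇔ (rearrange i j (ℕP.m∸n+n≡m (ℕP.<⇒≤ j<K)))
                                                                                 (trans (cong (j + (K ∸ i) + n +_) (ℕP.+-comm i j))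
                                                                                        (rearrange j i (ℕP.m∸n+n≡m (ℕP.<⇒≤ i<K)))) ⟩
      (((i * 2 + n) + K) % K ≡ ((j * 2 + n) + K) % K)                 ≈⟨ %-+ʳ-⇔ K (i * 2 + n) (j * 2 + n) ⟩
      ((i * 2 + n) % K ≡ (j * 2 + n) % K)                             ≈⟨ %-+ʳ-⇔ n (i * 2) (j * 2) ⟩
      ((i * 2) % K ≡ (j * 2) % K)                                     ≈⟨ *2-%-⇔ i j ⟩
      (i % n ≡ j % n)                                                 ∎
      where
      rearrange : ∀ a b → (K ∸ b) + b ≡ K → (a + (K ∸ b) + n) + (a + b) ≡ (a * 2 + n) + K
      rearrange a b e = trans (solve 4 (λ a b d n → (a :+ d :+ n) :+ (a :+ b) := (a :* con 2 :+ n) :+ (d :+ b))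
                                       refl a b (K ∸ b) n)
                              (cong ((a * 2 + n) +_) e)

    %n≡0-⇔ : ∀ i → i < K → (i % n ≡ 0) ⇔ (i ≡ 0 ⊎ i ≡ n)
    %n≡0-⇔ i i<K = mk⇔ to from
      where
      K≡n+n : K ≡ n + n
      K≡n+n = cong (n +_) (ℕP.+-identityʳ n)
      to : i % n ≡ 0 → i ≡ 0 ⊎ i ≡ n
      to e with i ℕP.<? n
      ... | yes i<n = inj₁ (trans (sym (m<n⇒m%n≡m i<n)) e)
      ... | no i≮n = inj₂ (trans (sym (ℕP.m∸n+n≡m n≤i)) (cong (_+ n) i∸n≡0))
        where
        n≤i = ℕP.≮⇒≥ i≮n
        i∸n<n : i ∸ n < n
        i∸n<n = ℕP.m<n+o⇒m∸n<o i n (subst₂ _<_ refl K≡n+n i<K)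
        i∸n≡0 : i ∸ n ≡ 0
        i∸n≡0 = trans (sym (m<n⇒m%n≡m i∸n<n)) (trans (m≤n⇒[n∸m]%m≡n%m n≤i) e)
      from : i ≡ 0 ⊎ i ≡ n → i % n ≡ 0
      from (inj₁ refl) = refl
      from (inj₂ refl) = n%n≡0 n

    -- x^i commutes with the y-element x^j y iff x^i is central, i.e. i ∈ {0, n}.
    xy-commute-⇔ : ∀ i j → i < K → j < K → ((i + j) % K ≡ (j + (K ∸ i)) % K) ⇔ (i ≡ 0 ⊎ i ≡ n)
    xy-commute-⇔ i j i<K j<K = begin
      ((i + j) % K ≡ (j + (K ∸ i)) % K)                               ≈⟨ %-+ʳ-⇔ (i + (K ∸ j)) (i + j) (j + (K ∸ i)) ⟨
      (((i + j) + (i + (K ∸ j))) % K ≡ ((j + (K ∸ i)) + (i + (K ∸ j))) % K)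
                                                                        ≈⟨ ≡⇒%-⇔ lhs rhs ⟩
      ((i * 2 + K) % K ≡ (K + K) % K)                                 ≈⟨ %-+ʳ-⇔ K (i * 2) K ⟩
      ((i * 2) % K ≡ K % K)                                           ≈⟨ mk⇔ (λ e → trans e (n%n≡0 K))
                                                                                (λ e → trans e (sym (n%n≡0 K))) ⟩
      ((i * 2) % K ≡ (0 * 2) % K)                                     ≈⟨ *2-%-⇔ i 0 ⟩
      (i % n ≡ 0)                                                     ≈⟨ %n≡0-⇔ i i<K ⟩
      (i ≡ 0 ⊎ i ≡ n)                                                 ∎
      where
      dᵢ = ℕP.m∸n+n≡m (ℕP.<⇒≤ i<K)
      dⱼ = ℕP.m∸n+n≡m (ℕP.<⇒≤ j<K)
      lhs : (i + j) + (i + (K ∸ j)) ≡ i * 2 + K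
      lhs = trans (solve 3 (λ i j d → (i :+ j) :+ (i :+ d) := i :* con 2 :+ (d :+ j)) refl i j (K ∸ j))
                  (cong (i * 2 +_) dⱼ)
      rhs : (j + (K ∸ i)) + (i + (K ∸ j)) ≡ K + K
      rhs = trans (solve 4 (λ i j dᵢ dⱼ → (j :+ dᵢ) :+ (i :+ dⱼ) := (dᵢ :+ i) :+ (dⱼ :+ j)) refl i j (K ∸ i) (K ∸ j))
                  (cong₂ _+_ dᵢ dⱼ)

  Element : Set
  Element = QElem n

  module NC = NonCommuting (qElems n) (qMul n) (qEq n)

  toℕ-mod : ∀ a → toℕ (a mod K) ≡ a % K
  toℕ-mod a = FinP.toℕ-fromℕ< _

  mod-pair-⇔ : ∀ a b (c : Bool) → ((a mod K , c) ≡ (b mod K , c)) ⇔ (a % K ≡ b % K)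
  mod-pair-⇔ a b c = mk⇔
    (λ e → trans (sym (toℕ-mod a)) (trans (cong (toℕ ∘ proj₁) e) (toℕ-mod b)))
    (λ e → cong (_, c) (FinP.toℕ-injective (trans (toℕ-mod a) (trans e (sym (toℕ-mod b))))))
    where open Function using (_∘_)

  qEq-mod : ∀ a b c {P : Set} (P? : Dec P) → (a % K ≡ b % K) ⇔ P →
    qEq n (a mod K , c) (b mod K , c) ≡ ⌊ P? ⌋
  qEq-mod a b c (yes p) a≡b⇔P =
    ⌊⌋-yes (≡-dec Fin._≟_ BoolP._≟_ _ _) (Equivalence.from (mod-pair-⇔ a b c) (Equivalence.from a≡b⇔P p))
  qEq-mod a b c (no ¬p) a≡b⇔P =
    ⌊⌋-no (≡-dec Fin._≟_ BoolP._≟_ _ _) (λ e → ¬p (Equivalence.to a≡b⇔P (Equivalence.to (mod-pair-⇔ a b c) e)))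

  centralIndex? : (x : ℕ) → Dec (x ≡ 0 ⊎ x ≡ n)
  centralIndex? x = (x ℕ.≟ 0) ⊎-dec (x ℕ.≟ n)

  isCentral : Element → Bool
  isCentral (i , b) = not b ∧ ⌊ centralIndex? (toℕ i) ⌋

  label : Element → ℕ
  label (i , false) = n
  label (i , true) = toℕ i % n

  commutes-xx : ∀ i j → NC.commutes (i , false) (j , false) ≡ true
  commutes-xx i j = ⌊⌋-yes (≡-dec Fin._≟_ BoolP._≟_ _ _)
    (Equivalence.from (mod-pair-⇔ (toℕ i + toℕ j) (toℕ j + toℕ i) false) (cong (_% K) (ℕP.+-comm (toℕ i) (toℕ j))))

  commutes-xy : ∀ i j → NC.commutes (i , false) (j , true) ≡ ⌊ centralIndex? (toℕ i) ⌋
  commutes-xy i j = qEq-mod (toℕ i + toℕ j) (toℕ j + (K ∸ toℕ i)) true (centralIndex? (toℕ i))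
    (xy-commute-⇔ (toℕ i) (toℕ j) (FinP.toℕ<n i) (FinP.toℕ<n j))

  commutes-yx : ∀ i j → NC.commutes (i , true) (j , false) ≡ ⌊ centralIndex? (toℕ j) ⌋
  commutes-yx i j = qEq-mod (toℕ i + (K ∸ toℕ j)) (toℕ j + toℕ i) true (centralIndex? (toℕ j))
    (begin
      ((toℕ i + (K ∸ toℕ j)) % K ≡ (toℕ j + toℕ i) % K)   ≈⟨ mk⇔ sym sym ⟩
      ((toℕ j + toℕ i) % K ≡ (toℕ i + (K ∸ toℕ j)) % K)
        ≈⟨ xy-commute-⇔ (toℕ j) (toℕ i) (FinP.toℕ<n j) (FinP.toℕ<n i) ⟩
      (toℕ j ≡ 0 ⊎ toℕ j ≡ n)                            ∎)
    where open import Relation.Binary.Reasoning.Setoid (⇔-setoid 0ℓ)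

  commutes-yy : ∀ i j → NC.commutes (i , true) (j , true) ≡ ⌊ toℕ i % n ℕ.≟ toℕ j % n ⌋
  commutes-yy i j = qEq-mod (toℕ i + (K ∸ toℕ j) + n) (toℕ j + (K ∸ toℕ i) + n) false (toℕ i % n ℕ.≟ toℕ j % n)
    (yy-commute-⇔ (toℕ i) (toℕ j) (FinP.toℕ<n i) (FinP.toℕ<n j))

  ∈-qElems : ∀ (j : Fin K) b → (j , b) ∈ qElems n
  ∈-qElems j false = ∈-cartesianProduct⁺ {xs = allFin K} {ys = false ∷ true ∷ []} (∈-allFin j) (here refl)
  ∈-qElems j true = ∈-cartesianProduct⁺ {xs = allFin K} {ys = false ∷ true ∷ []} (∈-allFin j) (there (here refl))

  allL-true : ∀ (p : Element → Bool) → (∀ h → p h ≡ true) → ∀ xs → NC.allL p xs ≡ true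
  allL-true p all-p [] = refl
  allL-true p all-p (x ∷ xs) rewrite all-p x = allL-true p all-p xs

  allL-false : ∀ (p : Element → Bool) xs h → h ∈ xs → p h ≡ false → NC.allL p xs ≡ false
  allL-false p (x ∷ xs) h (here refl) e rewrite e = refl
  allL-false p (x ∷ xs) h (there h∈xs) e rewrite allL-false p xs h h∈xs e = BoolP.∧-zeroʳ (p x)

  x¹ : Fin K
  x¹ = Fin.suc Fin.zero

  central≡isCentral : ∀ g → NC.central g ≡ isCentral g
  central≡isCentral (i , true) =
    allL-false (NC.commutes (i , true)) (qElems n) (x¹ , false) (∈-qElems x¹ false) (commutes-yx i x¹)
  central≡isCentral (i , false) = by-cases (centralIndex? (toℕ i))
    where
    by-cases : (d : Dec (toℕ i ≡ 0 ⊎ toℕ i ≡ n)) → NC.central (i , false) ≡ ⌊ d ⌋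
    by-cases (yes c) = allL-true (NC.commutes (i , false)) all-commute (qElems n)
      where
      all-commute : ∀ h → NC.commutes (i , false) h ≡ true
      all-commute (j , false) = commutes-xx i j
      all-commute (j , true) = trans (commutes-xy i j) (⌊⌋-yes (centralIndex? (toℕ i)) c)
    by-cases (no ¬c) = allL-false (NC.commutes (i , false)) (qElems n) (Fin.zero , true) (∈-qElems Fin.zero true)
                         (trans (commutes-xy i Fin.zero) (⌊⌋-no (centralIndex? (toℕ i)) ¬c))

  -- The classes are the non-central powers of x and the pairs {x^i y, x^(i+n) y}.
  commutes≡sameLabel : ∀ g h → isCentral g ≡ false → isCentral h ≡ false →
    NC.commutes g h ≡ ⌊ label g ℕ.≟ label h ⌋
  commutes≡sameLabel (i , false) (j , false) _ _ = trans (commutes-xx i j) (sym (⌊⌋-yes (n ℕ.≟ n) refl))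
  commutes≡sameLabel (i , false) (j , true) g-nc _ =
    trans (commutes-xy i j) (trans g-nc (sym (⌊⌋-no (n ℕ.≟ toℕ j % n) (λ e → ℕP.<-irrefl (sym e) (m%n<n (toℕ j) n)))))
  commutes≡sameLabel (i , true) (j , false) _ h-nc =
    trans (commutes-yx i j) (trans h-nc (sym (⌊⌋-no (toℕ i % n ℕ.≟ n) (λ e → ℕP.<-irrefl e (m%n<n (toℕ i) n)))))
  commutes≡sameLabel (i , true) (j , true) _ _ = commutes-yy i j

module VertexCount where

  open Booleans using (⌊⌋-yes; ⌊⌋-no)
  open Multipartite using (sum-const-1; sum-≡0; sum-single; ind)
  open import Data.Nat as ℕ using (ℕ; zero; suc; _+_; _*_; _%_; _<_)
  import Data.Nat.Properties as ℕP
  open import Data.Nat.DivMod using (m<n⇒m%n≡m; [m+n]%n≡m%n; m%n<n)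
  open import Data.Fin as Fin using (Fin; toℕ)
  import Data.Fin.Properties as FinP
  open import Data.Bool using (Bool; true; false; not; if_then_else_)
  open import Data.Product using (_×_; _,_)
  open import Data.List using (List; []; _∷_; lookup; filterᵇ; tabulate; _++_; map; cartesianProductWith; allFin)
  open import Relation.Binary.PropositionalEquality
    using (_≡_; refl; sym; trans; cong; cong₂; subst; module ≡-Reasoning)
  open import Relation.Nullary using (yes; no)
  open import Relation.Nullary.Decidable using (⌊_⌋)
  open import Function using (_∘_; id)
  open import Algebra.Properties.Semiring.Sum ℕP.+-*-semiring
    using (sum; sum-cong-≗; ∑-distrib-+)

  listSum : ∀ {A : Set} → (A → ℕ) → List A → ℕ
  listSum f [] = 0
  listSum f (x ∷ xs) = f x + listSum f xs

  sum-lookup : ∀ {A : Set} (xs : List A) (f : A → ℕ) → sum (f ∘ lookup xs) ≡ listSum f xs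
  sum-lookup [] f = refl
  sum-lookup (x ∷ xs) f = cong (f x +_) (sum-lookup xs f)

  listSum-filterᵇ : ∀ {A : Set} (p : A → Bool) (xs : List A) (f : A → ℕ) →
    listSum f (filterᵇ p xs) ≡ listSum (λ x → if p x then f x else 0) xs
  listSum-filterᵇ p [] f = refl
  listSum-filterᵇ p (x ∷ xs) f with p x
  ... | true = cong (f x +_) (listSum-filterᵇ p xs f)
  ... | false = listSum-filterᵇ p xs f

  listSum-++ : ∀ {A : Set} (f : A → ℕ) xs ys → listSum f (xs ++ ys) ≡ listSum f xs + listSum f ys
  listSum-++ f [] ys = refl
  listSum-++ f (x ∷ xs) ys = trans (cong (f x +_) (listSum-++ f xs ys)) (sym (ℕP.+-assoc (f x) _ _))

  listSum-map : ∀ {A B : Set} (f : B → ℕ) (g : A → B) xs → listSum f (map g xs) ≡ listSum (f ∘ g) xs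
  listSum-map f g [] = refl
  listSum-map f g (x ∷ xs) = cong (f (g x) +_) (listSum-map f g xs)

  listSum-cartesianProduct : ∀ {A B : Set} (f : A × B → ℕ) xs ys →
    listSum f (cartesianProductWith _,_ xs ys) ≡ listSum (λ x → listSum (λ y → f (x , y)) ys) xs
  listSum-cartesianProduct f [] ys = refl
  listSum-cartesianProduct f (x ∷ xs) ys =
    trans (listSum-++ f (map (x ,_) ys) _)
          (cong₂ _+_ (listSum-map f (x ,_) ys) (listSum-cartesianProduct f xs ys))

  listSum-allFin : ∀ n (g : Fin n → ℕ) → listSum g (allFin n) ≡ sum g
  listSum-allFin n g = tabulated n id
    where
    tabulated : ∀ k (h : Fin k → Fin n) → listSum g (tabulate h) ≡ sum (g ∘ h)
    tabulated zero h = refl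
    tabulated (suc k) h = cong (g (h Fin.zero) +_) (tabulated k (h ∘ Fin.suc))

  sumRange : ℕ → (ℕ → ℕ) → ℕ
  sumRange k h = sum {k} (h ∘ toℕ)

  sumRange-cong : ∀ k {h h′ : ℕ → ℕ} → (∀ x → x < k → h x ≡ h′ x) → sumRange k h ≡ sumRange k h′
  sumRange-cong k e = sum-cong-≗ (λ i → e (toℕ i) (FinP.toℕ<n i))

  sumRange-split : ∀ a b (h : ℕ → ℕ) → sumRange (a + b) h ≡ sumRange a h + sumRange b (λ x → h (a + x))
  sumRange-split zero b h = refl
  sumRange-split (suc a) b h = trans (cong (h 0 +_) (sumRange-split a b (h ∘ suc))) (sym (ℕP.+-assoc (h 0) _ _))

  sumRange-single : ∀ k c → c < k → sumRange k (λ x → ind ⌊ c ℕ.≟ x ⌋) ≡ 1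
  sumRange-single k c c<k = trans (sum-cong-≗ at-c) (sum-single k (Fin.fromℕ< c<k) 1)
    where
    at-c : ∀ i → ind ⌊ c ℕ.≟ toℕ i ⌋ ≡ (if eqFin i (Fin.fromℕ< c<k) then 1 else 0)
    at-c i with i Fin.≟ Fin.fromℕ< c<k
    ... | yes refl rewrite FinP.toℕ-fromℕ< c<k = cong ind (⌊⌋-yes (c ℕ.≟ c) refl)
    ... | no i≢c =
      cong ind (⌊⌋-no (c ℕ.≟ toℕ i) (λ e → i≢c (FinP.toℕ-injective (trans (sym e) (sym (FinP.toℕ-fromℕ< c<k))))))

  module QuaternionVertices (m : ℕ) where
    open QuaternionGroup m

    N : ℕ
    N = NC.N

    sum-vertices : ∀ F → sum (F ∘ NC.vtx) ≡
      sum {K} (λ i → (if not (isCentral (i , false)) then F (i , false) else 0) + (F (i , true) + 0))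
    sum-vertices F = begin
      sum (F ∘ NC.vtx)                                      ≡⟨ sum-lookup NC.vertices F ⟩
      listSum F NC.vertices                                 ≡⟨ listSum-filterᵇ (not ∘ NC.central) (qElems n) F ⟩
      listSum masked (qElems n)                             ≡⟨ listSum-cartesianProduct masked (allFin K) (false ∷ true ∷ []) ⟩
      listSum (λ i → masked (i , false) + (masked (i , true) + 0)) (allFin K)
                                                            ≡⟨ listSum-allFin K (λ i → masked (i , false) + (masked (i , true) + 0)) ⟩
      sum (λ i → masked (i , false) + (masked (i , true) + 0))
                                                            ≡⟨ sum-cong-≗ by-centre ⟩
      sum (λ i → (if not (isCentral (i , false)) then F (i , false) else 0) + (F (i , true) + 0)) ∎
      where
      open ≡-Reasoning
      masked : Element → ℕ
      masked g = if not (NC.central g) then F g else 0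
      by-centre : ∀ i → masked (i , false) + (masked (i , true) + 0)
                        ≡ (if not (isCentral (i , false)) then F (i , false) else 0) + (F (i , true) + 0)
      by-centre i rewrite central≡isCentral (i , false) | central≡isCentral (i , true) = refl

    nonCentralPowers : ℕ
    nonCentralPowers = sumRange K (λ x → ind (not ⌊ centralIndex? x ⌋))

    K≡n+n : K ≡ n + n
    K≡n+n = cong (n +_) (ℕP.+-identityʳ n)

    n<K : n < K
    n<K = subst (n <_) (sym K≡n+n) (ℕP.m<m+n n (ℕ.s≤s ℕ.z≤n))

    nonCentralPowers+2 : nonCentralPowers + 2 ≡ K
    nonCentralPowers+2 = begin
      nonCentralPowers + 2
        ≡⟨ cong (nonCentralPowers +_) (cong₂ _+_ (sumRange-single K 0 (ℕ.s≤s ℕ.z≤n)) (sumRange-single K n n<K)) ⟨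
      nonCentralPowers + (sumRange K is0 + sumRange K isN)
        ≡⟨ cong (nonCentralPowers +_) (∑-distrib-+ {K} (is0 ∘ toℕ) (isN ∘ toℕ)) ⟨
      nonCentralPowers + sumRange K (λ x → is0 x + isN x)
        ≡⟨ ∑-distrib-+ {K} (λ i → ind (not ⌊ centralIndex? (toℕ i) ⌋)) (λ i → is0 (toℕ i) + isN (toℕ i)) ⟨
      sumRange K (λ x → ind (not ⌊ centralIndex? x ⌋) + (is0 x + isN x))
        ≡⟨ sum-cong-≗ {K} (exactly-one ∘ toℕ) ⟩
      sum {K} (λ _ → 1)
        ≡⟨ sum-const-1 K ⟩
      K ∎
      where
      open ≡-Reasoning
      is0 isN : ℕ → ℕ
      is0 x = ind ⌊ 0 ℕ.≟ x ⌋
      isN x = ind ⌊ n ℕ.≟ x ⌋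
      exactly-one : ∀ x → ind (not ⌊ centralIndex? x ⌋) + (is0 x + isN x) ≡ 1
      exactly-one x with x ℕ.≟ 0 | x ℕ.≟ n
      ... | yes refl | yes ()
      ... | yes refl | no 0≢n rewrite ⌊⌋-no (n ℕ.≟ 0) (0≢n ∘ sym) = refl
      ... | no x≢0 | yes refl rewrite ⌊⌋-no (0 ℕ.≟ n) (x≢0 ∘ sym) | ⌊⌋-yes (n ℕ.≟ n) refl = refl
      ... | no x≢0 | no x≢n rewrite ⌊⌋-no (0 ℕ.≟ x) (x≢0 ∘ sym) | ⌊⌋-no (n ℕ.≟ x) (x≢n ∘ sym) = refl

    residue-count : ∀ ℓ → ℓ < n → sumRange K (λ x → ind ⌊ ℓ ℕ.≟ x % n ⌋) ≡ 2
    residue-count ℓ ℓ<n = begin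
      sumRange K h                                    ≡⟨ cong (λ k → sumRange k h) K≡n+n ⟩
      sumRange (n + n) h                              ≡⟨ sumRange-split n n h ⟩
      sumRange n h + sumRange n (λ x → h (n + x))     ≡⟨ cong₂ _+_ (sumRange-cong n first) (sumRange-cong n second) ⟩
      sumRange n single + sumRange n single           ≡⟨ cong₂ _+_ (sumRange-single n ℓ ℓ<n) (sumRange-single n ℓ ℓ<n) ⟩
      2                                               ∎
      where
      open ≡-Reasoning
      h single : ℕ → ℕ
      h x = ind ⌊ ℓ ℕ.≟ x % n ⌋
      single x = ind ⌊ ℓ ℕ.≟ x ⌋
      first : ∀ x → x < n → h x ≡ single x
      first x x<n = cong (λ r → ind ⌊ ℓ ℕ.≟ r ⌋) (m<n⇒m%n≡m x<n)
      second : ∀ x → x < n → h (n + x) ≡ single x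
      second x x<n =
        cong (λ r → ind ⌊ ℓ ℕ.≟ r ⌋) (trans (cong (_% n) (ℕP.+-comm n x)) (trans ([m+n]%n≡m%n x n) (m<n⇒m%n≡m x<n)))

    count-label : ∀ ℓ → sum (λ w → ind ⌊ ℓ ℕ.≟ label (NC.vtx w) ⌋) ≡
      (if ⌊ ℓ ℕ.≟ n ⌋ then nonCentralPowers else 0) + sumRange K (λ x → ind ⌊ ℓ ℕ.≟ x % n ⌋)
    count-label ℓ = begin
      sum (λ w → ind ⌊ ℓ ℕ.≟ label (NC.vtx w) ⌋)
        ≡⟨ sum-vertices (λ g → ind ⌊ ℓ ℕ.≟ label g ⌋) ⟩
      sum {K} (λ i → (if not (isCentral (i , false)) then ind ⌊ ℓ ℕ.≟ n ⌋ else 0) + (ind ⌊ ℓ ℕ.≟ toℕ i % n ⌋ + 0))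
        ≡⟨ sum-cong-≗ {K} (λ i → cong₂ _+_ (powers (toℕ i)) (ℕP.+-identityʳ (ind ⌊ ℓ ℕ.≟ toℕ i % n ⌋))) ⟩
      sumRange K (λ x → (if ⌊ ℓ ℕ.≟ n ⌋ then ind (not ⌊ centralIndex? x ⌋) else 0) + ind ⌊ ℓ ℕ.≟ x % n ⌋)
        ≡⟨ ∑-distrib-+ {K} (λ i → if ⌊ ℓ ℕ.≟ n ⌋ then ind (not ⌊ centralIndex? (toℕ i) ⌋) else 0)
                           (λ i → ind ⌊ ℓ ℕ.≟ toℕ i % n ⌋) ⟩
      sumRange K (λ x → if ⌊ ℓ ℕ.≟ n ⌋ then ind (not ⌊ centralIndex? x ⌋) else 0)
        + sumRange K (λ x → ind ⌊ ℓ ℕ.≟ x % n ⌋)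
        ≡⟨ cong (_+ sumRange K (λ x → ind ⌊ ℓ ℕ.≟ x % n ⌋)) (label-n? ⌊ ℓ ℕ.≟ n ⌋) ⟩
      (if ⌊ ℓ ℕ.≟ n ⌋ then nonCentralPowers else 0) + sumRange K (λ x → ind ⌊ ℓ ℕ.≟ x % n ⌋) ∎
      where
      open ≡-Reasoning
      powers : ∀ x → (if not ⌊ centralIndex? x ⌋ then ind ⌊ ℓ ℕ.≟ n ⌋ else 0)
                     ≡ (if ⌊ ℓ ℕ.≟ n ⌋ then ind (not ⌊ centralIndex? x ⌋) else 0)
      powers x with not ⌊ centralIndex? x ⌋ | ⌊ ℓ ℕ.≟ n ⌋
      ... | true | true = refl
      ... | true | false = refl
      ... | false | true = refl
      ... | false | false = refl
      label-n? : ∀ b → sumRange K (λ x → if b then ind (not ⌊ centralIndex? x ⌋) else 0)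
                       ≡ (if b then nonCentralPowers else 0)
      label-n? true = refl
      label-n? false = sum-≡0 K _ (λ _ → refl)

    count-label-n : sum (λ w → ind ⌊ n ℕ.≟ label (NC.vtx w) ⌋) ≡ nonCentralPowers
    count-label-n = trans (count-label n)
      (trans (cong₂ _+_ (cong (if_then nonCentralPowers else 0) (⌊⌋-yes (n ℕ.≟ n) refl))
                        (sum-≡0 K _ (λ i → cong ind (⌊⌋-no (n ℕ.≟ toℕ i % n) (λ e → ℕP.<-irrefl (sym e) (m%n<n (toℕ i) n))))))
             (ℕP.+-identityʳ nonCentralPowers))

    count-label-< : ∀ ℓ → ℓ < n → sum (λ w → ind ⌊ ℓ ℕ.≟ label (NC.vtx w) ⌋) ≡ 2
    count-label-< ℓ ℓ<n = trans (count-label ℓ)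
      (cong₂ _+_ (cong (if_then nonCentralPowers else 0) (⌊⌋-no (ℓ ℕ.≟ n) (λ e → ℕP.<-irrefl e ℓ<n)))
                 (residue-count ℓ ℓ<n))

    vertexCount : N ≡ nonCentralPowers + K
    vertexCount = begin
      N                                                   ≡⟨ sum-const-1 N ⟨
      sum {N} (λ _ → 1)                                   ≡⟨ sum-vertices (λ _ → 1) ⟩
      sum {K} (λ i → (if not (isCentral (i , false)) then 1 else 0) + (1 + 0))
        ≡⟨ ∑-distrib-+ {K} (λ i → if not (isCentral (i , false)) then 1 else 0) (λ _ → 1) ⟩
      nonCentralPowers + sum {K} (λ _ → 1)                ≡⟨ cong (nonCentralPowers +_) (sum-const-1 K) ⟩
      nonCentralPowers + K                                ∎
      where open ≡-Reasoning

module Distance where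

  open Booleans using (⌊⌋-no; ⌊⌋-true⇒)
  open Determinant using (eqFin-suc)
  open import Data.Nat as ℕ using (ℕ; zero; suc; _≤_; s≤s)
  import Data.Nat.Properties as ℕP
  open import Data.Fin as Fin using (Fin; zero; suc)
  open import Data.Bool using (Bool; true; false; not; _∧_; _∨_; if_then_else_)
  import Data.Bool.Properties as BoolP
  open import Data.Product using (Σ; _,_; proj₁; proj₂)
  open import Data.List using (List)
  open import Relation.Binary.PropositionalEquality using (_≡_; _≢_; refl; sym; trans; cong; cong₂)
  open import Relation.Nullary.Decidable using (⌊_⌋)
  open import Function using (_∘_)
  open import Algebra.Properties.Semiring.Sum ℕP.+-*-semiring using (sum)

  module GraphDistance {G : Set} (elems : List G) (_·_ : G → G → G) (_==_ : G → G → Bool) where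
    open NonCommuting elems _·_ _==_

    anyFin-false : ∀ m (f : Fin m → Bool) → (∀ w → f w ≡ false) → anyFin m f ≡ false
    anyFin-false zero f none = refl
    anyFin-false (suc m) f none rewrite none zero = anyFin-false m (f ∘ suc) (none ∘ suc)

    anyFin-witness : ∀ m (f : Fin m → Bool) w → f w ≡ true → anyFin m f ≡ true
    anyFin-witness (suc m) f zero e rewrite e = refl
    anyFin-witness (suc m) f (suc w) e rewrite anyFin-witness m (f ∘ suc) w e = BoolP.∨-zeroʳ (f zero)

    anyFin-cong : ∀ m {f g : Fin m → Bool} → (∀ w → f w ≡ g w) → anyFin m f ≡ anyFin m g
    anyFin-cong zero e = refl
    anyFin-cong (suc m) e = cong₂ _∨_ (e zero) (anyFin-cong m (e ∘ suc))

    anyFin-at : ∀ m (u : Fin m) (g : Fin m → Bool) → anyFin m (λ w → eqFin u w ∧ g w) ≡ g u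
    anyFin-at (suc m) zero g =
      trans (cong (g zero ∨_) (anyFin-false m _ (λ w → refl))) (BoolP.∨-identityʳ (g zero))
    anyFin-at (suc m) (suc u) g =
      trans (anyFin-cong m (λ w → cong (_∧ g (suc w)) (eqFin-suc u w))) (anyFin-at m u (g ∘ suc))

    sumℕ≡sum : ∀ m (f : Fin m → ℕ) → sumℕ m f ≡ sum f
    sumℕ≡sum zero f = refl
    sumℕ≡sum (suc m) f = cong (f zero ℕ.+_) (sumℕ≡sum m (f ∘ suc))

    minK-0 : ∀ B f → f 0 ≡ true → minK (suc B) f ≡ 0
    minK-0 B f e rewrite e = refl

    minK-1 : ∀ B f → f 0 ≡ false → f 1 ≡ true → minK (suc (suc B)) f ≡ 1
    minK-1 B f e₀ e₁ rewrite e₀ | e₁ = refl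

    minK-2 : ∀ B f → f 0 ≡ false → f 1 ≡ false → f 2 ≡ true → minK (suc (suc (suc B))) f ≡ 2
    minK-2 B f e₀ e₁ e₂ rewrite e₀ | e₁ | e₂ = refl

    reach-1 : ∀ u v → reach 1 u v ≡ (eqFin u v ∨ adj u v)
    reach-1 u v = cong (eqFin u v ∨_) (anyFin-at N u (λ w → adj w v))

    module ByLabel (label : Fin N → ℕ)
      (commutes≡sameLabel : ∀ u v → commutes (vtx u) (vtx v) ≡ ⌊ label u ℕ.≟ label v ⌋)
      (other-label : ∀ u → Σ (Fin N) (λ w → label w ≢ label u))
      (3≤N : 3 ≤ N) where

      sameLabel : Fin N → Fin N → Bool
      sameLabel u v = ⌊ label u ℕ.≟ label v ⌋

      adj≡ : ∀ u v → adj u v ≡ not (sameLabel u v)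
      adj≡ u v = cong not (commutes≡sameLabel u v)

      path-through-other-part : ∀ u v → sameLabel u v ≡ true → anyFin N (λ w → reach 1 u w ∧ adj w v) ≡ true
      path-through-other-part u v u~v = anyFin-witness N _ w (cong₂ _∧_ u-w w-v)
        where
        w = proj₁ (other-label u)
        w≁u = proj₂ (other-label u)
        u-w : reach 1 u w ≡ true
        u-w = trans (reach-1 u w)
                (trans (cong (eqFin u w ∨_) (trans (adj≡ u w) (cong not (⌊⌋-no (label u ℕ.≟ label w) (w≁u ∘ sym)))))
                       (BoolP.∨-zeroʳ (eqFin u w)))
        w-v : adj w v ≡ true
        w-v = trans (adj≡ w v) (cong not (⌊⌋-no (label w ℕ.≟ label v)
                (λ e → w≁u (trans e (sym (⌊⌋-true⇒ (label u ℕ.≟ label v) u~v))))))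

      dist≡ : ∀ u v → dist u v ≡ (if eqFin u v then 0 else (if sameLabel u v then 2 else 1))
      dist≡ u v = by-cases 3≤N (eqFin u v) refl (sameLabel u v) refl
        where
        reach₁ : ∀ {b s} → eqFin u v ≡ b → sameLabel u v ≡ s → reach 1 u v ≡ (b ∨ not s)
        reach₁ u≐v u~v = trans (reach-1 u v) (cong₂ _∨_ u≐v (trans (adj≡ u v) (cong not u~v)))
        by-cases : ∀ {B} → 3 ≤ B → ∀ b → eqFin u v ≡ b → ∀ s → sameLabel u v ≡ s →
          minK B (λ k → reach k u v) ≡ (if b then 0 else (if s then 2 else 1))
        by-cases {suc (suc (suc B))} (s≤s (s≤s (s≤s _))) true u≐v _ _ =
          minK-0 (suc (suc B)) (λ k → reach k u v) u≐v
        by-cases {suc (suc (suc B))} (s≤s (s≤s (s≤s _))) false u≢v false u≁v =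
          minK-1 (suc B) (λ k → reach k u v) u≢v (reach₁ u≢v u≁v)
        by-cases {suc (suc (suc B))} (s≤s (s≤s (s≤s _))) false u≢v true u~v =
          minK-2 B (λ k → reach k u v) u≢v (reach₁ u≢v u~v)
                 (trans (cong (_∨ anyFin N (λ w → reach 1 u w ∧ adj w v)) (reach₁ u≢v u~v))
                        (path-through-other-part u v u~v))

open PolyAlgebra
open Determinant
open Booleans
open Multipartite
open VertexCount using (module QuaternionVertices)
open Distance using (module GraphDistance)
open import Data.Nat as ℕ using (ℕ; zero; suc; _+_; _*_; _∸_; _%_; _<_; _≤_; s≤s; z≤n)
import Data.Nat.Properties as ℕP
open import Data.Nat.DivMod using (m%n<n)
open import Data.Nat.Solver using (module +-*-Solver)
open import Data.Integer as ℤ using (+_; -_)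
import Data.Integer.Properties as ℤP
open import Data.Fin as Fin using (Fin; toℕ)
open import Data.Bool using (Bool; true; false; not; _∧_; if_then_else_; T)
import Data.Bool.Properties as BoolP
open import Data.Product using (Σ; _,_; proj₁; proj₂)
open import Data.List using (List; _∷_; length; lookup; filterᵇ)
open import Data.List.Membership.Propositional using (_∈_)
open import Data.List.Membership.Propositional.Properties using (∈-filter⁺)
import Data.List.Relation.Unary.Any as Any
open import Data.List.Relation.Unary.Any.Properties using (lookup-index)
open import Relation.Binary.PropositionalEquality
  using (_≡_; _≢_; refl; sym; trans; cong; cong₂; subst; module ≡-Reasoning)
open import Relation.Nullary using (yes; no)
open import Relation.Nullary.Decidable using (⌊_⌋; T?)
open import Function using (_∘_)
open import Algebra.Properties.Semiring.Sum ℕP.+-*-semiring using (sum; sum-cong-≗; ∑-distrib-+; *-distribˡ-sum)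

filterᵇ-lookup : ∀ {A : Set} (p : A → Bool) (xs : List A) (w : Fin (length (filterᵇ p xs))) →
  p (lookup (filterᵇ p xs) w) ≡ true
filterᵇ-lookup p (x ∷ xs) w with p x in px
filterᵇ-lookup p (x ∷ xs) Fin.zero | true = px
filterᵇ-lookup p (x ∷ xs) (Fin.suc w) | true = filterᵇ-lookup p xs w
... | false = filterᵇ-lookup p xs w

∸-from-+ : ∀ {x k y} → x + k ≡ y → y ∸ k ≡ x
∸-from-+ {x} {k} refl = ℕP.m+n∸n≡m x k

-- Here a stands for the 2n − 2 non-central powers of x and N = a + 2n for the number of vertices.
module VertexArithmetic {a n N : ℕ} (a+2≡2n : a + 2 ≡ 2 * n) (N≡a+2n : N ≡ a + 2 * n) where
  open +-*-Solver

  N+2≡4n : N + 2 ≡ 4 * n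
  N+2≡4n = begin
    N + 2              ≡⟨ cong (_+ 2) N≡a+2n ⟩
    a + 2 * n + 2      ≡⟨ solve 2 (λ a n → a :+ con 2 :* n :+ con 2 := (a :+ con 2) :+ con 2 :* n) refl a n ⟩
    (a + 2) + 2 * n    ≡⟨ cong (_+ 2 * n) a+2≡2n ⟩
    2 * n + 2 * n      ≡⟨ solve 1 (λ n → con 2 :* n :+ con 2 :* n := con 4 :* n) refl n ⟩
    4 * n              ∎
    where open ≡-Reasoning

  N+a+4≡6n : N + a + 4 ≡ 6 * n
  N+a+4≡6n = begin
    N + a + 4                  ≡⟨ cong (λ v → v + a + 4) N≡a+2n ⟩
    a + 2 * n + a + 4          ≡⟨ solve 2 (λ a n → a :+ con 2 :* n :+ a :+ con 4
                                                    := (a :+ con 2) :+ con 2 :* n :+ (a :+ con 2)) refl a n ⟩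
    (a + 2) + 2 * n + (a + 2)  ≡⟨ cong (λ b → b + 2 * n + b) a+2≡2n ⟩
    2 * n + 2 * n + 2 * n      ≡⟨ solve 1 (λ n → con 2 :* n :+ con 2 :* n :+ con 2 :* n := con 6 :* n) refl n ⟩
    6 * n                      ∎
    where open ≡-Reasoning

  N≡4n∸2 : N ≡ 4 * n ∸ 2
  N≡4n∸2 = sym (∸-from-+ N+2≡4n)

  N+a≡6n∸4 : N + a ≡ 6 * n ∸ 4
  N+a≡6n∸4 = sym (∸-from-+ N+a+4≡6n)

module GeneralisedQuaternion (m : ℕ) where
  open QuaternionGroup m
  open QuaternionVertices m

  part : Fin N → ℕ
  part = label ∘ NC.vtx

  vertex-nonCentral : ∀ u → isCentral (NC.vtx u) ≡ false
  vertex-nonCentral u =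
    trans (sym (central≡isCentral (NC.vtx u)))
          (not≡true⇒≡false (filterᵇ-lookup (not ∘ NC.central) (qElems n) u))

  vertex-of : ∀ g → isCentral g ≡ false → Σ (Fin N) (λ w → NC.vtx w ≡ g)
  vertex-of g g-nc = Any.index g∈vertices , sym (lookup-index g∈vertices)
    where
    non-central : T (not (NC.central g))
    non-central rewrite central≡isCentral g | g-nc = _
    g∈vertices : g ∈ NC.vertices
    g∈vertices = ∈-filter⁺ (T? ∘ (not ∘ NC.central)) (∈-qElems (proj₁ g) (proj₂ g)) non-central

  x-vertex : Fin N
  x-vertex = proj₁ (vertex-of (x¹ , false) refl)

  part-x-vertex : part x-vertex ≡ n
  part-x-vertex = cong label (proj₂ (vertex-of (x¹ , false) refl))

  y-vertex : Fin N
  y-vertex = proj₁ (vertex-of (Fin.zero , true) refl)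

  part-y-vertex : part y-vertex ≡ 0
  part-y-vertex = cong label (proj₂ (vertex-of (Fin.zero , true) refl))

  other-part : ∀ u → Σ (Fin N) (λ w → part w ≢ part u)
  other-part u with part u ℕ.≟ n
  ... | yes u∈n = y-vertex , λ e → ℕP.0≢1+n (trans (sym part-y-vertex) (trans e u∈n))
  ... | no u∉n = x-vertex , λ e → u∉n (trans (sym e) part-x-vertex)

  3≤N : 3 ≤ N
  3≤N = subst (3 ≤_) (sym vertexCount)
          (ℕP.≤-trans (s≤s (s≤s (ℕP.≤-trans (s≤s z≤n) (ℕP.m≤n+m (1 * n) m)))) (ℕP.m≤n+m K nonCentralPowers))

  module Graph = GraphDistance (qElems n) (qMul n) (qEq n)
  module ByPart = Graph.ByLabel part
    (λ u v → commutes≡sameLabel (NC.vtx u) (NC.vtx v) (vertex-nonCentral u) (vertex-nonCentral v))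
    other-part 3≤N
  module Γ = CompleteMultipartite N part x-vertex

  transmission≡ : ∀ i → NC.transmission i ≡ Γ.transmission i
  transmission≡ i = trans (Graph.sumℕ≡sum N (NC.dist i)) (sum-cong-≗ (ByPart.dist≡ i))

  dist≡ : ∀ {i j b} → eqFin i j ≡ b → NC.dist i j ≡ (if b then 0 else Γ.distinctDist i j)
  dist≡ {i} {j} i≐j = trans (ByPart.dist≡ i j) (cong (if_then 0 else Γ.distinctDist i j) i≐j)

  charMatrix≈ : ∀ i j →
    (if eqFin i j then X ⊕ const (- QDL n i j) else const (- QDL n i j)) ≈ Γ.charMatrix i j
  charMatrix≈ i j with eqFin i j in i≐j
  ... | true = ⊕-cong {p = X} ≈-refl (const-cong (begin
    - (+ NC.transmission i ℤ.- + NC.dist i j)  ≡⟨ cong (λ d → - (+ NC.transmission i ℤ.- + d)) (dist≡ i≐j) ⟩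
    - (+ NC.transmission i ℤ.- + 0)            ≡⟨ cong -_ (ℤP.+-identityʳ _) ⟩
    - + NC.transmission i                      ≡⟨ cong (λ t → - + t) (transmission≡ i) ⟩
    - + Γ.transmission i                       ∎))
    where open ≡-Reasoning
  ... | false = const-cong (begin
    - (+ 0 ℤ.- + NC.dist i j)                  ≡⟨ cong -_ (ℤP.+-identityˡ _) ⟩
    - - + NC.dist i j                          ≡⟨ ℤP.neg-involutive _ ⟩
    + NC.dist i j                              ≡⟨ cong +_ (dist≡ i≐j) ⟩
    + Γ.distinctDist i j                       ∎)
    where open ≡-Reasoning

  charPoly≈det : charPoly N (QDL n) ≈ det N Γ.charMatrix
  charPoly≈det = det-cong N charMatrix≈

  isBig : Fin N → Bool
  isBig u = ⌊ n ℕ.≟ part u ⌋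

  partSize≡ : ∀ u → Γ.partSize u ≡ (if isBig u then nonCentralPowers else 2)
  partSize≡ u = by-label (NC.vtx u) refl
    where
    size-of : ∀ ℓ → part u ≡ ℓ → Γ.partSize u ≡ sum (λ w → ind ⌊ ℓ ℕ.≟ part w ⌋)
    size-of ℓ e = sum-cong-≗ (λ w → cong (λ k → ind ⌊ k ℕ.≟ part w ⌋) e)
    by-label : ∀ g → NC.vtx u ≡ g → Γ.partSize u ≡ (if isBig u then nonCentralPowers else 2)
    by-label (i , false) vᵤ =
      trans (size-of n (cong label vᵤ))
            (trans count-label-n (cong (if_then nonCentralPowers else 2) (sym (⌊⌋-yes (n ℕ.≟ part u) (sym (cong label vᵤ))))))
    by-label (i , true) vᵤ =
      trans (size-of (toℕ i % n) (cong label vᵤ))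
            (trans (count-label-< (toℕ i % n) (m%n<n (toℕ i) n))
                   (cong (if_then nonCentralPowers else 2)
                         (sym (⌊⌋-no (n ℕ.≟ part u)
                                (λ e → ℕP.<-irrefl (trans (sym (cong label vᵤ)) (sym e)) (m%n<n (toℕ i) n))))))

  bigReps : count N (λ u → Γ.isRep u ∧ isBig u) ≡ 1
  bigReps = Γ.count-reps-of-part x-vertex n part-x-vertex

  smallReps : count N (λ u → Γ.isRep u ∧ not (isBig u)) ≡ n
  smallReps = ℕP.*-cancelˡ-≡ _ n 2 (ℕP.+-cancelˡ-≡ nonCentralPowers _ (2 * n) (begin
    nonCentralPowers + 2 * count N small
      ≡⟨ cong (_+ 2 * count N small) (trans (sym (ℕP.*-identityʳ nonCentralPowers)) (cong (nonCentralPowers *_) (sym bigReps))) ⟩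
    nonCentralPowers * count N big + 2 * count N small
      ≡⟨ cong₂ _+_ (*-distribˡ-sum nonCentralPowers (ind ∘ big)) (*-distribˡ-sum 2 (ind ∘ small)) ⟩
    sum (λ k → nonCentralPowers * ind (big k)) + sum (λ k → 2 * ind (small k))
      ≡⟨ ∑-distrib-+ (λ k → nonCentralPowers * ind (big k)) (λ k → 2 * ind (small k)) ⟨
    sum (λ k → nonCentralPowers * ind (big k) + 2 * ind (small k))
      ≡⟨ sum-cong-≗ by-kind ⟩
    sum (λ k → if Γ.isRep k then Γ.partSize k else 0)
      ≡⟨ Γ.sum-partSize-reps ⟩
    N
      ≡⟨ vertexCount ⟩
    nonCentralPowers + K ∎))
    where
    open ≡-Reasoning
    big small : Fin N → Bool
    big u = Γ.isRep u ∧ isBig u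
    small u = Γ.isRep u ∧ not (isBig u)
    by-kind : ∀ k → nonCentralPowers * ind (big k) + 2 * ind (small k) ≡ (if Γ.isRep k then Γ.partSize k else 0)
    by-kind k = by-cases (Γ.isRep k) (isBig k) refl
      where
      by-cases : ∀ r b → isBig k ≡ b →
        nonCentralPowers * ind (r ∧ b) + 2 * ind (r ∧ not b) ≡ (if r then Γ.partSize k else 0)
      by-cases true true big-k =
        trans (trans (ℕP.+-identityʳ _) (ℕP.*-identityʳ nonCentralPowers))
              (sym (trans (partSize≡ k) (cong (if_then nonCentralPowers else 2) big-k)))
      by-cases true false small-k =
        trans (cong (_+ 2) (ℕP.*-zeroʳ nonCentralPowers))
              (sym (trans (partSize≡ k) (cong (if_then nonCentralPowers else 2) small-k)))
      by-cases false b _ = trans (ℕP.+-identityʳ _) (ℕP.*-zeroʳ nonCentralPowers)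

  count-big : count N isBig ≡ nonCentralPowers
  count-big = count-label-n

  bigMembers : nonCentralPowers ≡ 1 + count N (λ u → not (Γ.isRep u) ∧ isBig u)
  bigMembers = trans (sym count-big)
    (trans (count-split N Γ.isRep isBig) (cong (_+ count N (λ u → not (Γ.isRep u) ∧ isBig u)) bigReps))

  smallMembers : count N (λ u → not (Γ.isRep u) ∧ not (isBig u)) ≡ n
  smallMembers = ℕP.+-cancelˡ-≡ n (count N members) n (begin
    n + count N members                                    ≡⟨ cong (_+ count N members) smallReps ⟨
    count N (λ u → Γ.isRep u ∧ not (isBig u)) + count N members
                                                           ≡⟨ count-split N Γ.isRep (not ∘ isBig) ⟨
    count N (not ∘ isBig)                                  ≡⟨ ℕP.+-cancelˡ-≡ nonCentralPowers _ K complement ⟩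
    K                                                      ≡⟨ K≡n+n ⟩
    n + n                                                  ∎)
    where
    open ≡-Reasoning
    members : Fin N → Bool
    members u = not (Γ.isRep u) ∧ not (isBig u)
    complement : nonCentralPowers + count N (not ∘ isBig) ≡ nonCentralPowers + K
    complement = trans (cong (_+ count N (not ∘ isBig)) (sym count-big))
                       (trans (count-complement N isBig) vertexCount)

  otherReps : count N (λ u → not (eqFin u Γ.pivot) ∧ Γ.isRep u) ≡ n
  otherReps = ℕP.+-cancelˡ-≡ 1 (count N others) n (trans (sym by-pivot) by-size)
    where
    others : Fin N → Bool
    others u = not (eqFin u Γ.pivot) ∧ Γ.isRep u
    by-pivot : count N Γ.isRep ≡ 1 + count N others
    by-pivot = trans (count-split N (λ u → eqFin u Γ.pivot) Γ.isRep)
      (cong (_+ count N others)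
            (trans (count-cong N (λ u → BoolP.∧-comm (eqFin u Γ.pivot) (Γ.isRep u))) Γ.count-pivot))
    by-size : count N Γ.isRep ≡ 1 + n
    by-size = trans (count-split N isBig Γ.isRep)
      (cong₂ _+_ (trans (count-cong N (λ u → BoolP.∧-comm (isBig u) (Γ.isRep u))) bigReps)
                 (trans (count-cong N (λ u → BoolP.∧-comm (not (isBig u)) (Γ.isRep u))) smallReps))

  bigMemberCount : ℕ
  bigMemberCount = count N (λ u → not (Γ.isRep u) ∧ isBig u)

  eigenvalue-factors : prodP N Γ.eigenFactor ≈
    X ^^ 1 ⊗ lin (+ N) ^^ n ⊗ lin (+ (N + 2)) ^^ n ⊗ lin (+ (N + nonCentralPowers)) ^^ bigMemberCount
  eigenvalue-factors =
    ≈-trans (prodP-cong N split)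
    (≈-trans (≈-sym (prodP-⊗ N _ fB))
    (⊗-cong (≈-trans (≈-sym (prodP-⊗ N _ fS))
               (⊗-cong (≈-trans (≈-sym (prodP-⊗ N fX fN))
                          (⊗-cong (≈-trans (prodP-count N _ X) (≈-reflexive (cong (X ^^_) Γ.count-pivot)))
                                  (≈-trans (prodP-count N _ (lin (+ N))) (≈-reflexive (cong (lin (+ N) ^^_) otherReps)))))
                       (≈-trans (prodP-count N _ (lin (+ (N + 2)))) (≈-reflexive (cong (lin (+ (N + 2)) ^^_) smallMembers)))))
            (prodP-count N _ (lin (+ (N + nonCentralPowers))))))
    where
    fX fN fS fB : Fin N → Poly
    fX u = if Γ.isRep u ∧ eqFin u Γ.pivot then X else one
    fN u = if not (eqFin u Γ.pivot) ∧ Γ.isRep u then lin (+ N) else one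
    fS u = if not (Γ.isRep u) ∧ not (isBig u) then lin (+ (N + 2)) else one
    fB u = if not (Γ.isRep u) ∧ isBig u then lin (+ (N + nonCentralPowers)) else one
    split : ∀ u → Γ.eigenFactor u ≈ fX u ⊗ fN u ⊗ fS u ⊗ fB u
    split u = by-cases (Γ.isRep u) (eqFin u Γ.pivot) (isBig u) refl
      where
      member : ∀ {b} → isBig u ≡ b → Γ.memberFactor u ≈ lin (+ (N + (if b then nonCentralPowers else 2)))
      member e = ≈-reflexive (cong (λ s → lin (+ (N + s))) (trans (partSize≡ u) (cong (if_then nonCentralPowers else 2) e)))
      big-member : isBig u ≡ true →
        Γ.memberFactor u ≈ one ⊗ one ⊗ one ⊗ lin (+ (N + nonCentralPowers))
      big-member big-u =
        ≈-trans (member big-u)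
          (≈-sym (≈-trans (⊗-congˡ (lin (+ (N + nonCentralPowers))) (≈-trans (⊗-identityʳ _) (⊗-identityˡ one)))
                          (⊗-identityˡ _)))
      small-member : isBig u ≡ false → Γ.memberFactor u ≈ one ⊗ one ⊗ lin (+ (N + 2)) ⊗ one
      small-member small-u = ≈-trans (member small-u) (≈-sym (≈-trans (⊗-identityʳ _) (⊗-identityˡ _)))
      by-cases : ∀ r p b → isBig u ≡ b →
        (if r then (if p then X else lin (+ N)) else Γ.memberFactor u)
        ≈ (if r ∧ p then X else one) ⊗ (if not p ∧ r then lin (+ N) else one)
          ⊗ (if not r ∧ not b then lin (+ (N + 2)) else one)
          ⊗ (if not r ∧ b then lin (+ (N + nonCentralPowers)) else one)
      by-cases true true _ _ = ≈-sym (≈-trans (⊗-identityʳ _) (≈-trans (⊗-identityʳ _) (⊗-identityʳ X)))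
      by-cases true false _ _ =
        ≈-sym (≈-trans (⊗-identityʳ _) (≈-trans (⊗-identityʳ _) (⊗-identityˡ (lin (+ N)))))
      by-cases false true true = big-member
      by-cases false false true = big-member
      by-cases false true false = small-member
      by-cases false false false = small-member

  module Arithmetic = VertexArithmetic {nonCentralPowers} {n} {N} nonCentralPowers+2 vertexCount

  bigMemberCount≡2n∸3 : bigMemberCount ≡ 2 * n ∸ 3
  bigMemberCount≡2n∸3 = sym (∸-from-+ (begin
    bigMemberCount + 3        ≡⟨ ℕP.+-comm bigMemberCount 3 ⟩
    2 + (1 + bigMemberCount)  ≡⟨ ℕP.+-comm 2 (1 + bigMemberCount) ⟩
    1 + bigMemberCount + 2    ≡⟨ cong (_+ 2) bigMembers ⟨
    nonCentralPowers + 2      ≡⟨ nonCentralPowers+2 ⟩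
    2 * n                     ∎))
    where open ≡-Reasoning

  charPoly≈ : charPoly N (QDL n) ≈
    lin (+ 0) ⊗ lin (+ (4 * n ∸ 2)) ^^ n ⊗ lin (+ (4 * n)) ^^ n ⊗ lin (+ (6 * n ∸ 4)) ^^ (2 * n ∸ 3)
  charPoly≈ = begin
    charPoly N (QDL n)     ≈⟨ charPoly≈det ⟩
    det N Γ.charMatrix     ≈⟨ Γ.det-charMatrix ⟩
    prodP N Γ.eigenFactor  ≈⟨ eigenvalue-factors ⟩
    X ^^ 1 ⊗ lin (+ N) ^^ n ⊗ lin (+ (N + 2)) ^^ n ⊗ lin (+ (N + nonCentralPowers)) ^^ bigMemberCount
      ≈⟨ ⊗-cong (⊗-cong (⊗-cong (⊗-identityʳ X) (factor Arithmetic.N≡4n∸2 n)) (factor Arithmetic.N+2≡4n n))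
                (≈-reflexive (cong₂ (λ e k → lin (+ e) ^^ k) Arithmetic.N+a≡6n∸4 bigMemberCount≡2n∸3)) ⟩
    lin (+ 0) ⊗ lin (+ (4 * n ∸ 2)) ^^ n ⊗ lin (+ (4 * n)) ^^ n ⊗ lin (+ (6 * n ∸ 4)) ^^ (2 * n ∸ 3) ∎
    where
    open import Relation.Binary.Reasoning.Setoid ≈-setoid
    factor : ∀ {a b} → a ≡ b → ∀ k → lin (+ a) ^^ k ≈ lin (+ b) ^^ k
    factor refl k = ≈-refl

theorem3p2 : (n : ℕ) → 2 ≤ n →
    charPoly (QN n) (QDL n)
      ≈ₚ (lin (+ 0) ⊗ (lin (+ (4 * n ∸ 2)) ^^ n) ⊗ (lin (+ (4 * n)) ^^ n)
            ⊗ (lin (+ (6 * n ∸ 4)) ^^ (2 * n ∸ 3)))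
theorem3p2 (suc (suc m)) _ = app (GeneralisedQuaternion.charPoly≈ m)
theorem3p2 (suc zero) (s≤s ())
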